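{- For $a,y\in\mathbb{Z}_{>0}$ and $c\in\mathbb{Z}$ let $$p=a^2(2a+1)^2y^2-a(2a+1)(8a+5)y+(4c-9)a^2+(4c-5)a+c,$$ $$q=16a^4y^2-8a^2(8a+1)y+4(4c-9)a^2+16a+1,$$ $$k=4a^3(2a+1)y^2-a(32a^2+20a+1)y+2(4c-9)a^2+(4c-1)a.$$ (1) $pq=k^2+5k+c$. Moreover, for fixed $a$ and $c$, $p<q<4p$ for all sufficiently large $y$, and $$\lim_{y\to\infty}\frac{q}{p}=\Bigl(2-\frac{2}{2a+1}\Bigr)^2<4,\qquad \lim_{a\to\infty}\lim_{y\to\infty}\frac{q}{p}=4.$$ (2) Regard $p=p(y)$ and $q=q(y)$ as polynomials in $\mathbb{Z}[y]$. If $c\in\{\pm1,\pm3,\pm5\}$ and $a\equiv 1,4,7,13\pmod{15}$, then $f_1=p(y)$, $f_2=q(y)$ satisfy the conditions: (i) $f_1,f_2$ are distinct; (ii) each is irreducible in $\mathbb{Z}[y]$; (iii) each has positive leading coefficient; (iv) there is no prime $\ell$ dividing $f_1(n)f_2(n)$ for all $n\in\mathbb{Z}_{>0}$. -}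

module Defs where

open import Data.Nat as ℕ using (ℕ; zero; suc)
open import Data.Integer as ℤ using (ℤ; +_; -[1+_])
open import Data.Rational as ℚ using (ℚ)
open import Data.List using (List; []; _∷_)
open import Data.Product using (∃-syntax; _×_)
open import Data.Sum using (_⊎_)
open import Relation.Binary.PropositionalEquality using (_≡_)
open import Relation.Nullary using (¬_)
open import Data.Nat.Primality using (Prime)
open import Data.Integer.Divisibility using (_∣_)

-- Polynomials in ℤ[y], represented by coefficient lists, lowest degree
-- first:  a₀ ∷ a₁ ∷ … ∷ aₙ ∷ []  stands for a₀ + a₁ y + … + aₙ yⁿ.
-- Trailing zeros are allowed; equality of polynomials is equality of
-- all coefficients (_≈ₚ_ below).

Poly : Set
Poly = List ℤ

coeff : Poly → ℕ → ℤ
coeff []       _       = + 0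
coeff (x ∷ xs) zero    = x
coeff (x ∷ xs) (suc i) = coeff xs i

_≈ₚ_ : Poly → Poly → Set
f ≈ₚ g = ∀ i → coeff f i ≡ coeff g i

_+ₚ_ : Poly → Poly → Poly
[]       +ₚ g        = g
(x ∷ xs) +ₚ []       = x ∷ xs
(x ∷ xs) +ₚ (y ∷ ys) = (x ℤ.+ y) ∷ (xs +ₚ ys)

scale : ℤ → Poly → Poly
scale c []       = []
scale c (x ∷ xs) = (c ℤ.* x) ∷ scale c xs

_*ₚ_ : Poly → Poly → Poly
[]       *ₚ g = []
(x ∷ xs) *ₚ g = scale x g +ₚ (+ 0 ∷ (xs *ₚ g))

eval : Poly → ℤ → ℤ
eval []       y = + 0
eval (x ∷ xs) y = x ℤ.+ y ℤ.* eval xs y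

-- leading coefficient (the last nonzero coefficient; 0 for the zero polynomial)
lead : Poly → ℤ
lead []       = + 0
lead (x ∷ xs) with lead xs
... | + zero = x
... | l      = l

-- units of ℤ[y] are exactly the constants ±1
IsUnit : Poly → Set
IsUnit f = (f ≈ₚ (+ 1 ∷ [])) ⊎ (f ≈ₚ (ℤ.- (+ 1) ∷ []))

Irreducible : Poly → Set
Irreducible f = ¬ IsUnit f × (∀ g h → f ≈ₚ (g *ₚ h) → IsUnit g ⊎ IsUnit h)

pPoly : ℤ → ℤ → Poly
pPoly a c =
  (((+ 4 ℤ.* c ℤ.- + 9) ℤ.* a ℤ.* a) ℤ.+ ((+ 4 ℤ.* c ℤ.- + 5) ℤ.* a) ℤ.+ c)
  ∷ (ℤ.- (a ℤ.* (+ 2 ℤ.* a ℤ.+ + 1) ℤ.* (+ 8 ℤ.* a ℤ.+ + 5)))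
  ∷ (a ℤ.* a ℤ.* (+ 2 ℤ.* a ℤ.+ + 1) ℤ.* (+ 2 ℤ.* a ℤ.+ + 1))
  ∷ []

qPoly : ℤ → ℤ → Poly
qPoly a c =
  ((+ 4 ℤ.* (+ 4 ℤ.* c ℤ.- + 9) ℤ.* a ℤ.* a) ℤ.+ (+ 16 ℤ.* a) ℤ.+ + 1)
  ∷ (ℤ.- (+ 8 ℤ.* a ℤ.* a ℤ.* (+ 8 ℤ.* a ℤ.+ + 1)))
  ∷ (+ 16 ℤ.* a ℤ.* a ℤ.* a ℤ.* a)
  ∷ []

kPoly : ℤ → ℤ → Poly
kPoly a c =
  ((+ 2 ℤ.* (+ 4 ℤ.* c ℤ.- + 9) ℤ.* a ℤ.* a) ℤ.+ ((+ 4 ℤ.* c ℤ.- + 1) ℤ.* a))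
  ∷ (ℤ.- (a ℤ.* ((+ 32 ℤ.* a ℤ.* a) ℤ.+ (+ 20 ℤ.* a) ℤ.+ + 1)))
  ∷ (+ 4 ℤ.* a ℤ.* a ℤ.* a ℤ.* (+ 2 ℤ.* a ℤ.+ + 1))
  ∷ []

p q k : ℤ → ℤ → ℤ → ℤ
p a c y = eval (pPoly a c) y
q a c y = eval (qPoly a c) y
k a c y = eval (kPoly a c) y

-- Rationals: total quotient of integers (x / 0 := 0) and limits along ℕ

ratio : ℤ → ℤ → ℚ
ratio x (+ zero)   = ℚ.0ℚ
ratio x (+ suc n)  = x ℚ./ suc n
ratio x -[1+ n ]   = (ℤ.- x) ℚ./ suc n

Tendsto : (ℕ → ℚ) → ℚ → Set
Tendsto f L = ∀ (ε : ℚ) → ℚ.0ℚ ℚ.< ε →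
  ∃[ N ] (∀ n → N ℕ.≤ n → ℚ.∣ f n ℚ.- L ∣ ℚ.< ε)

limQP : ℕ → ℚ
limQP a = (ℚ.1ℚ ℚ.+ ℚ.1ℚ ℚ.- (+ 2 ℚ./ suc (2 ℕ.* a)))
          ℚ.* (ℚ.1ℚ ℚ.+ ℚ.1ℚ ℚ.- (+ 2 ℚ./ suc (2 ℕ.* a)))

Conditions : Poly → Poly → Set
Conditions f₁ f₂ =
    ¬ (f₁ ≈ₚ f₂)
  × (Irreducible f₁ × Irreducible f₂)
  × ((+ 0 ℤ.< lead f₁) × (+ 0 ℤ.< lead f₂))
  × ¬ (∃[ ℓ ] (Prime ℓ × (∀ (n : ℕ) → 1 ℕ.≤ n →
         (+ ℓ) ∣ (eval f₁ (+ n) ℤ.* eval f₂ (+ n)))))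

-- The leading coefficients satisfy
-- q₂ - p₂ = a²(2a - 1)(6a + 1) > 0 and 4p₂ - q₂ = 4a²(4a + 1) > 0, so q - p and 4p - q are eventually
-- positive, and q/p tends to q₂/p₂ = (4a/(2a + 1))² = (2 - 2/(2a + 1))², itself a ratio of quadratics
-- in a with leading coefficients 16 and 4.
--
-- (2): p and q are primitive (p₀ ≡ c mod a with c prime to a, 4p₀ ≡ 1 mod 2a + 1; q₀ is odd and
-- ≡ 1 mod a), and their discriminants are squares times 25 - 4c ∈ {21, 29, 13, 37, 5, 45}, never a
-- square, so neither splits over ℤ.  A prime ℓ ≥ 5 dividing p(n)q(n) for n = 1, …, 5 would divide p
-- or q at three points distinct mod ℓ, hence all its coefficients.  The prime 2 is excluded since
-- p(1)q(1) ≡ c (mod 2), and 3 since a ≡ 1 (mod 3) gives p ≡ 1 and q ≡ y² + c + 2 (mod 3).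

module Submission where

open import Defs
open import Data.Nat as ℕ using (ℕ; zero; suc; z≤n; s≤s; NonZero; nonTrivial⇒≢1; _%_)
import Data.Nat.Properties as ℕP
import Data.Nat.Divisibility as ℕ∣
open import Data.Nat.DivMod using (m*[n/m]≡n; m≡m%n+[m/n]*n; m∣n⇒o%n%m≡o%m)
open import Data.Nat.GCD using (gcd; gcd[m,n]∣m; gcd[m,n]∣n; gcd[m,n]≢0)
open import Data.Nat.Coprimality as Coprime using (Coprime; coprime-/gcd; coprime-divisor)
open import Data.Nat.Primality
  using ( Prime; prime?; euclidsLemma; prime⇒nonTrivial; prime⇒irreducible; prime⇒¬composite
        ; ¬prime[0]; ¬prime[1]; composite[4])
import Data.Nat.Tactic.RingSolver as ℕ-Solver
open import Data.Integer as ℤ using (ℤ; +_; -[1+_]; +[1+_]; _+_; _*_; -_; _-_; _<_; _≤_; +<+)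
import Data.Integer.Properties as ℤP
open import Data.Integer.Divisibility.Signed
  using ( _∣_; _∣?_; divides; ∣ᵤ⇒∣; ∣⇒∣ᵤ; ∣-trans; ∣m∣∣m
        ; ∣m∣n⇒∣m-n; ∣m∣n⇒∣m+n; ∣m+n∣m⇒∣n; ∣m⇒∣m*n; ∣n⇒∣m*n)
import Data.Integer.Divisibility as Unsigned
open import Data.Integer.Tactic.RingSolver
open import Data.Rational as ℚ using (ℚ; mkℚ; toℚᵘ)
import Data.Rational.Properties as ℚP
open import Data.Rational.Unnormalised as ℚᵘ using (ℚᵘ; mkℚᵘ; *≡*)
open import Data.List using ([]; _∷_)
open import Data.List.Membership.Propositional using (_∈_)
open import Data.List.Relation.Unary.Any using (here; there)
open import Data.Product using (∃-syntax; _×_; _,_; proj₁; proj₂)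
open import Data.Sum as Sum using (_⊎_; inj₁; inj₂; [_,_]′)
open import Data.Empty using (⊥-elim)
open import Relation.Nullary using (¬_; Dec; yes; no; contradiction)
open import Relation.Nullary.Decidable using (True; toWitness; map′; from-yes; from-no)
open import Relation.Binary.Definitions using (tri<; tri≈; tri>)
open import Relation.Binary.PropositionalEquality

coeff-+ₚ : ∀ f g i → coeff (f +ₚ g) i ≡ coeff f i + coeff g i
coeff-+ₚ []       g        i       = sym (ℤP.+-identityˡ _)
coeff-+ₚ (x ∷ f)  []       i       = sym (ℤP.+-identityʳ _)
coeff-+ₚ (x ∷ f)  (y ∷ g)  zero    = refl
coeff-+ₚ (x ∷ f)  (y ∷ g)  (suc i) = coeff-+ₚ f g i

coeff-scale : ∀ c f i → coeff (scale c f) i ≡ c * coeff f i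
coeff-scale c []      i       = sym (ℤP.*-zeroʳ c)
coeff-scale c (x ∷ f) zero    = refl
coeff-scale c (x ∷ f) (suc i) = coeff-scale c f i

coeff₀-*ₚ : ∀ g h → coeff (g *ₚ h) 0 ≡ coeff g 0 * coeff h 0
coeff₀-*ₚ []      h = refl
coeff₀-*ₚ (x ∷ g) h = begin
  coeff (scale x h +ₚ (+ 0 ∷ (g *ₚ h))) 0 ≡⟨ coeff-+ₚ (scale x h) _ 0 ⟩
  coeff (scale x h) 0 + + 0               ≡⟨ ℤP.+-identityʳ _ ⟩
  coeff (scale x h) 0                     ≡⟨ coeff-scale x h 0 ⟩
  x * coeff h 0                           ∎
  where open ≡-Reasoning

coeff-suc-*ₚ : ∀ x g h i → coeff ((x ∷ g) *ₚ h) (suc i) ≡ x * coeff h (suc i) + coeff (g *ₚ h) i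
coeff-suc-*ₚ x g h i = trans (coeff-+ₚ (scale x h) _ (suc i)) (cong (_+ coeff (g *ₚ h) i) (coeff-scale x h (suc i)))

-- The equation (always refl) lets the coefficients of a concrete polynomial be read off by unification.
eval-quadratic : ∀ f {f₀ f₁ f₂} → f ≡ f₀ ∷ f₁ ∷ f₂ ∷ [] → ∀ y → eval f y ≡ f₂ * y * y + f₁ * y + f₀
eval-quadratic _ {f₀} {f₁} {f₂} refl y = horner f₀ f₁ f₂ y
  where
  horner : ∀ f₀ f₁ f₂ y → f₀ + y * (f₁ + y * (f₂ + y * + 0)) ≡ f₂ * y * y + f₁ * y + f₀
  horner = solve-∀

eval-scale : ∀ c f y → eval (scale c f) y ≡ c * eval f y
eval-scale c []      y = sym (ℤP.*-zeroʳ c)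
eval-scale c (x ∷ f) y = begin
  c * x + y * eval (scale c f) y ≡⟨ cong (λ v → c * x + y * v) (eval-scale c f y) ⟩
  c * x + y * (c * eval f y)     ≡⟨ distribute c x y (eval f y) ⟩
  c * (x + y * eval f y)         ∎
  where
  open ≡-Reasoning
  distribute : ∀ c x y v → c * x + y * (c * v) ≡ c * (x + y * v)
  distribute = solve-∀

DegreeAtMost : Poly → ℕ → Set
DegreeAtMost f n = ∀ i → n ℕ.< i → coeff f i ≡ + 0

IsZero : Poly → Set
IsZero f = ∀ i → coeff f i ≡ + 0

zero-or-degree : ∀ f → IsZero f ⊎ ∃[ n ] (¬ coeff f n ≡ + 0 × DegreeAtMost f n)
zero-or-degree [] = inj₁ λ _ → refl
zero-or-degree (x ∷ f) with zero-or-degree f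
... | inj₂ (n , fₙ≢0 , deg) = inj₂ (suc n , fₙ≢0 , λ { (suc i) (s≤s n<i) → deg i n<i })
... | inj₁ f≡0 with x ℤ.≟ + 0
...   | yes x≡0 = inj₁ λ { zero → x≡0 ; (suc i) → f≡0 i }
...   | no  x≢0 = inj₂ (0 , x≢0 , λ { (suc i) _ → f≡0 i })

*ₚ-zeroˡ : ∀ g h → IsZero g → IsZero (g *ₚ h)
*ₚ-zeroˡ []      h g≡0 i       = refl
*ₚ-zeroˡ (x ∷ g) h g≡0 zero    = trans (coeff₀-*ₚ (x ∷ g) h) (cong (_* coeff h 0) (g≡0 0))
*ₚ-zeroˡ (x ∷ g) h g≡0 (suc i) = begin
  coeff ((x ∷ g) *ₚ h) (suc i)           ≡⟨ coeff-suc-*ₚ x g h i ⟩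
  x * coeff h (suc i) + coeff (g *ₚ h) i
    ≡⟨ cong₂ (λ u v → u * coeff h (suc i) + v) (g≡0 0) (*ₚ-zeroˡ g h (λ j → g≡0 (suc j)) i) ⟩
  + 0                                    ∎
  where open ≡-Reasoning

coeff-*ₚ-constantˡ : ∀ g h → DegreeAtMost g 0 → ∀ i → coeff (g *ₚ h) i ≡ coeff g 0 * coeff h i
coeff-*ₚ-constantˡ []      h _   i       = refl
coeff-*ₚ-constantˡ (x ∷ g) h _   zero    = coeff₀-*ₚ (x ∷ g) h
coeff-*ₚ-constantˡ (x ∷ g) h deg (suc i) = begin
  coeff ((x ∷ g) *ₚ h) (suc i)           ≡⟨ coeff-suc-*ₚ x g h i ⟩
  x * coeff h (suc i) + coeff (g *ₚ h) i
    ≡⟨ cong (_+_ (x * coeff h (suc i))) (*ₚ-zeroˡ g h (λ j → deg (suc j) (s≤s z≤n)) i) ⟩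
  x * coeff h (suc i) + + 0              ≡⟨ ℤP.+-identityʳ _ ⟩
  x * coeff h (suc i)                    ∎
  where open ≡-Reasoning

coeff-*ₚ-constantʳ : ∀ g h → DegreeAtMost h 0 → ∀ i → coeff (g *ₚ h) i ≡ coeff g i * coeff h 0
coeff-*ₚ-constantʳ []      h _   i       = refl
coeff-*ₚ-constantʳ (x ∷ g) h _   zero    = coeff₀-*ₚ (x ∷ g) h
coeff-*ₚ-constantʳ (x ∷ g) h deg (suc i) = begin
  coeff ((x ∷ g) *ₚ h) (suc i)           ≡⟨ coeff-suc-*ₚ x g h i ⟩
  x * coeff h (suc i) + coeff (g *ₚ h) i
    ≡⟨ cong₂ _+_ (trans (cong (x *_) (deg (suc i) (s≤s z≤n))) (ℤP.*-zeroʳ x)) (coeff-*ₚ-constantʳ g h deg i) ⟩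
  + 0 + coeff g i * coeff h 0            ≡⟨ ℤP.+-identityˡ _ ⟩
  coeff g i * coeff h 0                  ∎
  where open ≡-Reasoning

degree-*ₚ : ∀ g h m n → DegreeAtMost g m → DegreeAtMost h n →
            DegreeAtMost (g *ₚ h) (m ℕ.+ n) × coeff (g *ₚ h) (m ℕ.+ n) ≡ coeff g m * coeff h n
degree-*ₚ g h zero n degg degh = bound , coeff-*ₚ-constantˡ g h degg n
  where
  bound : DegreeAtMost (g *ₚ h) n
  bound i n<i = trans (coeff-*ₚ-constantˡ g h degg i) (trans (cong (coeff g 0 *_) (degh i n<i)) (ℤP.*-zeroʳ (coeff g 0)))
degree-*ₚ []      h (suc m) n degg degh = (λ _ _ → refl) , refl
degree-*ₚ (x ∷ g) h (suc m) n degg degh = bound , top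
  where
  ih : DegreeAtMost (g *ₚ h) (m ℕ.+ n) × coeff (g *ₚ h) (m ℕ.+ n) ≡ coeff g m * coeff h n
  ih = degree-*ₚ g h m n (λ i m<i → degg (suc i) (s≤s m<i)) degh
  x*hᵢ≡0 : ∀ i → m ℕ.+ n ℕ.< i → x * coeff h i ≡ + 0
  x*hᵢ≡0 i m+n<i = trans (cong (x *_) (degh i (ℕP.≤-<-trans (ℕP.m≤n+m n m) m+n<i))) (ℤP.*-zeroʳ x)
  bound : DegreeAtMost ((x ∷ g) *ₚ h) (suc m ℕ.+ n)
  bound (suc i) (s≤s m+n<i) = trans (coeff-suc-*ₚ x g h i)
    (cong₂ _+_ (x*hᵢ≡0 (suc i) (ℕP.<-trans m+n<i (ℕP.n<1+n i))) (proj₁ ih i m+n<i))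
  top : coeff ((x ∷ g) *ₚ h) (suc m ℕ.+ n) ≡ coeff g m * coeff h n
  top = trans (coeff-suc-*ₚ x g h (m ℕ.+ n))
    (trans (cong₂ _+_ (x*hᵢ≡0 (suc (m ℕ.+ n)) (ℕP.n<1+n _)) (proj₂ ih)) (ℤP.+-identityˡ _))

coeff₁-*ₚ : ∀ g h → coeff (g *ₚ h) 1 ≡ coeff g 0 * coeff h 1 + coeff g 1 * coeff h 0
coeff₁-*ₚ []      h = refl
coeff₁-*ₚ (x ∷ g) h = trans (coeff-suc-*ₚ x g h 0) (cong (_+_ (x * coeff h 1)) (coeff₀-*ₚ g h))

Primitive : Poly → Set
Primitive f = ∀ {d} → (∀ i → + d ∣ coeff f i) → d ≡ 1

unit-if-constant : ∀ g → DegreeAtMost g 0 → ℤ.∣ coeff g 0 ∣ ≡ 1 → IsUnit g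
unit-if-constant g deg ∣g₀∣≡1 with coeff g 0 in g₀≡ | ∣g₀∣≡1
... | + 1      | _ = inj₁ λ { zero → g₀≡ ; (suc i) → deg (suc i) (s≤s z≤n) }
... | -[1+ 0 ] | _ = inj₂ λ { zero → g₀≡ ; (suc i) → deg (suc i) (s≤s z≤n) }

constant-divisor-unit : ∀ f g → Primitive f → DegreeAtMost g 0 → (∀ i → coeff g 0 ∣ coeff f i) → IsUnit g
constant-divisor-unit f g prim deg g₀∣f = unit-if-constant g deg (prim λ i → ∣-trans ∣m∣∣m (g₀∣f i))

discriminant-of-product : ∀ {f₀ f₁ f₂} g₀ g₁ h₀ h₁ →
  f₀ ≡ g₀ * h₀ → f₁ ≡ g₀ * h₁ + g₁ * h₀ → f₂ ≡ g₁ * h₁ →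
  f₁ * f₁ - + 4 * f₀ * f₂ ≡ (g₀ * h₁ - g₁ * h₀) * (g₀ * h₁ - g₁ * h₀)
discriminant-of-product g₀ g₁ h₀ h₁ refl refl refl = solve (g₀ ∷ g₁ ∷ h₀ ∷ h₁ ∷ [])

module _ {f₀ f₁ f₂ : ℤ} (f₂≢0 : ¬ f₂ ≡ + 0) where

  private
    f : Poly
    f = f₀ ∷ f₁ ∷ f₂ ∷ []

  degrees-of-factors : ∀ g h m n → f ≈ₚ (g *ₚ h) →
    ¬ coeff g m ≡ + 0 → DegreeAtMost g m → ¬ coeff h n ≡ + 0 → DegreeAtMost h n → m ℕ.+ n ≡ 2
  degrees-of-factors g h m n f≈gh gₘ≢0 degg hₙ≢0 degh with degree-*ₚ g h m n degg degh | ℕP.<-cmp (m ℕ.+ n) 2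
  ... | deg , _   | tri< m+n<2 _ _ = ⊥-elim (f₂≢0 (trans (f≈gh 2) (deg 2 m+n<2)))
  ... | _         | tri≈ _ m+n≡2 _ = m+n≡2
  ... | _ , top   | tri> _ _ 2<m+n =
    ⊥-elim (gₘhₙ≢0 (trans (sym top) (trans (sym (f≈gh (m ℕ.+ n))) (coeff-beyond-2 2<m+n))))
    where
    gₘhₙ≢0 : ¬ coeff g m * coeff h n ≡ + 0
    gₘhₙ≢0 gₘhₙ≡0 with ℤP.i*j≡0⇒i≡0∨j≡0 (coeff g m) gₘhₙ≡0
    ... | inj₁ gₘ≡0 = gₘ≢0 gₘ≡0
    ... | inj₂ hₙ≡0 = hₙ≢0 hₙ≡0
    coeff-beyond-2 : ∀ {i} → 2 ℕ.< i → coeff f i ≡ + 0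
    coeff-beyond-2 {suc (suc (suc i))} _                   = refl
    coeff-beyond-2 {suc (suc zero)}     (s≤s (s≤s ()))
    coeff-beyond-2 {suc zero}           (s≤s ())

  quadratic-irreducible : Primitive f → ¬ (∃[ x ] x * x ≡ f₁ * f₁ - + 4 * f₀ * f₂) → Irreducible f
  quadratic-irreducible prim nonsquare = not-unit , factors
    where
    not-unit : ¬ IsUnit f
    not-unit (inj₁ f≈1)  = f₂≢0 (f≈1 2)
    not-unit (inj₂ f≈-1) = f₂≢0 (f≈-1 2)

    factors : ∀ g h → f ≈ₚ (g *ₚ h) → IsUnit g ⊎ IsUnit h
    factors g h f≈gh with zero-or-degree g | zero-or-degree h
    ... | inj₁ g≡0 | _ = ⊥-elim (f₂≢0 (trans (f≈gh 2) (*ₚ-zeroˡ g h g≡0 2)))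
    ... | inj₂ _   | inj₁ h≡0 = ⊥-elim (f₂≢0 (begin
      f₂                    ≡⟨ f≈gh 2 ⟩
      coeff (g *ₚ h) 2      ≡⟨ coeff-*ₚ-constantʳ g h (λ i _ → h≡0 i) 2 ⟩
      coeff g 2 * coeff h 0 ≡⟨ cong (coeff g 2 *_) (h≡0 0) ⟩
      coeff g 2 * + 0       ≡⟨ ℤP.*-zeroʳ (coeff g 2) ⟩
      + 0                   ∎))
      where open ≡-Reasoning
    ... | inj₂ (m , gₘ≢0 , degg) | inj₂ (n , hₙ≢0 , degh) =
      by-degrees m n degg degh (degrees-of-factors g h m n f≈gh gₘ≢0 degg hₙ≢0 degh)
      where
      by-degrees : ∀ m n → DegreeAtMost g m → DegreeAtMost h n → m ℕ.+ n ≡ 2 → IsUnit g ⊎ IsUnit h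
      by-degrees 0 _ degg _ _ = inj₁ (constant-divisor-unit f g prim degg λ i →
        divides (coeff h i) (trans (f≈gh i) (trans (coeff-*ₚ-constantˡ g h degg i) (ℤP.*-comm (coeff g 0) (coeff h i)))))
      by-degrees 2 0 _ degh _ = inj₂ (constant-divisor-unit f h prim degh λ i →
        divides (coeff g i) (trans (f≈gh i) (coeff-*ₚ-constantʳ g h degh i)))
      by-degrees 1 1 degg degh _ = ⊥-elim (nonsquare (coeff g 0 * coeff h 1 - coeff g 1 * coeff h 0 , sym
        (discriminant-of-product (coeff g 0) (coeff g 1) (coeff h 0) (coeff h 1)
          (trans (f≈gh 0) (coeff₀-*ₚ g h))
          (trans (f≈gh 1) (coeff₁-*ₚ g h))
          (trans (f≈gh 2) (proj₂ (degree-*ₚ g h 1 1 degg degh))))))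
      by-degrees 1 0 _ _ ()
      by-degrees 1 (suc (suc _)) _ _ ()
      by-degrees 2 (suc _) _ _ ()
      by-degrees (suc (suc (suc _))) _ _ _ ()

IsSquare : ℕ → Set
IsSquare d = ∃[ t ] t ℕ.* t ≡ d

square? : ∀ d → Dec (IsSquare d)
square? d = map′ (λ (t , _ , t²≡d) → t , t²≡d) (λ (t , t²≡d) → t , root-bound t²≡d , t²≡d)
                 (ℕP.anyUpTo? (λ t → t ℕ.* t ℕ.≟ d) (suc d))
  where
  root-bound : ∀ {t} → t ℕ.* t ≡ d → t ℕ.< suc d
  root-bound {zero}  _     = s≤s z≤n
  root-bound {suc t} t²≡d = s≤s (subst (suc t ℕ.≤_) t²≡d (ℕP.m≤m*n (suc t) (suc t)))

square-of-product : ∀ m n → (m ℕ.* n) ℕ.* (m ℕ.* n) ≡ (m ℕ.* m) ℕ.* (n ℕ.* n)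
square-of-product = ℕ-Solver.solve-∀

-- Cancelling gcd(x, s) from x² = s² d leaves x′² = s′² d with x′, s′ coprime, forcing s′ = 1.
square-times-nonsquare : ∀ {d s} → ¬ IsSquare d → ¬ s ≡ 0 → ¬ IsSquare (s ℕ.* s ℕ.* d)
square-times-nonsquare {d} {s} nonsquare s≢0 (x , x²≡s²d) = nonsquare (x′ , x′²≡d)
  where
  g x′ s′ : ℕ
  g = gcd x s
  instance
    g≢0 : NonZero g
    g≢0 = ℕ.≢-nonZero (gcd[m,n]≢0 x s (inj₂ s≢0))
    g²≢0 : NonZero (g ℕ.* g)
    g²≢0 = ℕP.m*n≢0 g g
  x′ = x ℕ./ g
  s′ = s ℕ./ g
  x′s′-coprime : Coprime x′ s′
  x′s′-coprime = coprime-/gcd x s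
  reduced : x′ ℕ.* x′ ≡ s′ ℕ.* s′ ℕ.* d
  reduced = ℕP.*-cancelˡ-≡ (x′ ℕ.* x′) (s′ ℕ.* s′ ℕ.* d) (g ℕ.* g) (begin
    (g ℕ.* g) ℕ.* (x′ ℕ.* x′)       ≡⟨ square-of-product g x′ ⟨
    (g ℕ.* x′) ℕ.* (g ℕ.* x′)       ≡⟨ cong (λ u → u ℕ.* u) (m*[n/m]≡n (gcd[m,n]∣m x s)) ⟩
    x ℕ.* x                         ≡⟨ x²≡s²d ⟩
    s ℕ.* s ℕ.* d                   ≡⟨ cong (λ u → u ℕ.* u ℕ.* d) (sym (m*[n/m]≡n (gcd[m,n]∣n x s))) ⟩
    (g ℕ.* s′) ℕ.* (g ℕ.* s′) ℕ.* d ≡⟨ cong (ℕ._* d) (square-of-product g s′) ⟩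
    (g ℕ.* g) ℕ.* (s′ ℕ.* s′) ℕ.* d ≡⟨ ℕP.*-assoc (g ℕ.* g) (s′ ℕ.* s′) d ⟩
    (g ℕ.* g) ℕ.* (s′ ℕ.* s′ ℕ.* d) ∎)
    where open ≡-Reasoning
  s′∣x′ : s′ ℕ∣.∣ x′
  s′∣x′ = coprime-divisor (Coprime.sym x′s′-coprime)
            (ℕ∣.divides (s′ ℕ.* d) (trans reduced (trans (ℕP.*-assoc s′ s′ d) (ℕP.*-comm s′ (s′ ℕ.* d)))))
  s′≡1 : s′ ≡ 1
  s′≡1 = Coprime.sym x′s′-coprime (ℕ∣.∣-refl , s′∣x′)
  x′²≡d : x′ ℕ.* x′ ≡ d
  x′²≡d = trans reduced (trans (cong (λ u → u ℕ.* u ℕ.* d) s′≡1) (ℕP.*-identityˡ d))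

square-times-nonsquareℤ : ∀ {D d} S → D ≡ S * S * + d → ¬ IsSquare d → ¬ S ≡ + 0 → ¬ (∃[ x ] x * x ≡ D)
square-times-nonsquareℤ {d = d} S refl nonsquare S≢0 (x , x²≡S²d) =
  square-times-nonsquare nonsquare (λ ∣S∣≡0 → S≢0 (ℤP.∣i∣≡0⇒i≡0 ∣S∣≡0)) (ℤ.∣ x ∣ , (begin
    ℤ.∣ x ∣ ℕ.* ℤ.∣ x ∣           ≡⟨ ℤP.abs-* x x ⟨
    ℤ.∣ x * x ∣                   ≡⟨ cong ℤ.∣_∣ x²≡S²d ⟩
    ℤ.∣ S * S * + d ∣             ≡⟨ ℤP.abs-* (S * S) (+ d) ⟩
    ℤ.∣ S * S ∣ ℕ.* d             ≡⟨ cong (ℕ._* d) (ℤP.abs-* S S) ⟩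
    ℤ.∣ S ∣ ℕ.* ℤ.∣ S ∣ ℕ.* d     ∎))
  where open ≡-Reasoning

coprime-* : ∀ {m n o} → Coprime m n → Coprime m o → Coprime m (n ℕ.* o)
coprime-* m⊥n m⊥o (i∣m , i∣no) =
  m⊥o (i∣m , coprime-divisor (λ (j∣i , j∣n) → m⊥n (ℕ∣.∣-trans j∣i i∣m , j∣n)) i∣no)

-- Coprimality of integers, as a record so that both arguments can be inferred.
infix 4 _⊥_

record _⊥_ (x y : ℤ) : Set where
  constructor coprime
  field coprime-abs : Coprime ℤ.∣ x ∣ ℤ.∣ y ∣

⊥-* : ∀ {x y z} → x ⊥ y → x ⊥ z → x ⊥ (y * z)
⊥-* {x} {y} {z} (coprime x⊥y) (coprime x⊥z) =
  coprime (subst (Coprime ℤ.∣ x ∣) (sym (ℤP.abs-* y z)) (coprime-* x⊥y x⊥z))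

⊥-1 : ∀ {x} → x ⊥ + 1
⊥-1 = coprime λ (_ , i∣1) → ℕ∣.∣1⇒≡1 i∣1

-- A common divisor of n and m divides k n - m x = r.
⊥-linear : ∀ {k n m x r} → m ⊥ r → k * n ≡ m * x + r → n ⊥ m
⊥-linear {k} {n} {m} {x} {r} (coprime m⊥r) kn≡mx+r =
  coprime λ {i} (i∣n , i∣m) → m⊥r (i∣m , ∣⇒∣ᵤ (i∣r i∣n i∣m))
  where
  i∣r : ∀ {i} → i ℕ∣.∣ ℤ.∣ n ∣ → i ℕ∣.∣ ℤ.∣ m ∣ → + i ∣ r
  i∣r {i} i∣n i∣m = ∣m+n∣m⇒∣n {m = m * x}
    (subst (+ i ∣_) kn≡mx+r (∣n⇒∣m*n k (∣ᵤ⇒∣ i∣n))) (∣m⇒∣m*n x (∣ᵤ⇒∣ {+ i} {m} i∣m))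

prime∤⇒coprime : ∀ {ℓ a} → Prime ℓ → ¬ ℓ ℕ∣.∣ a → Coprime a ℓ
prime∤⇒coprime ℓ-prime ℓ∤a (i∣a , i∣ℓ) with prime⇒irreducible ℓ-prime i∣ℓ
... | inj₁ i≡1 = i≡1
... | inj₂ refl = contradiction i∣a ℓ∤a

primitive-if-coprime : ∀ {f₀ f₁ f₂} → f₀ ⊥ f₂ → Primitive (f₀ ∷ f₁ ∷ f₂ ∷ [])
primitive-if-coprime (coprime f₀⊥f₂) d∣f = f₀⊥f₂ (∣⇒∣ᵤ (d∣f 0) , ∣⇒∣ᵤ (d∣f 2))

euclid-ℤ : ∀ {ℓ} x y → Prime ℓ → + ℓ ∣ x * y → + ℓ ∣ x ⊎ + ℓ ∣ y
euclid-ℤ {ℓ} x y ℓ-prime ℓ∣xy =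
  Sum.map ∣ᵤ⇒∣ ∣ᵤ⇒∣
    (euclidsLemma ℤ.∣ x ∣ ℤ.∣ y ∣ ℓ-prime (subst (ℓ ℕ∣.∣_) (ℤP.abs-* x y) (∣⇒∣ᵤ ℓ∣xy)))

∤-* : ∀ {ℓ} x y → Prime ℓ → ¬ + ℓ ∣ x → ¬ + ℓ ∣ y → ¬ + ℓ ∣ x * y
∤-* x y ℓ-prime ℓ∤x ℓ∤y ℓ∣xy with euclid-ℤ x y ℓ-prime ℓ∣xy
... | inj₁ ℓ∣x = ℓ∤x ℓ∣x
... | inj₂ ℓ∣y = ℓ∤y ℓ∣y

∤-congruent : ∀ {m r x} → ¬ m ∣ r → m ∣ x - r → ¬ m ∣ x
∤-congruent {m} {r} {x} m∤r m∣x-r m∣x = m∤r (subst (m ∣_) (x-[x-r]≡r x r) (∣m∣n⇒∣m-n m∣x m∣x-r))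
  where
  x-[x-r]≡r : ∀ x r → x - (x - r) ≡ r
  x-[x-r]≡r = solve-∀

prime-cases : ∀ {ℓ} → Prime ℓ → ℓ ≡ 2 ⊎ ℓ ≡ 3 ⊎ 5 ℕ.≤ ℓ
prime-cases {0} ℓ-prime = contradiction ℓ-prime ¬prime[0]
prime-cases {1} ℓ-prime = contradiction ℓ-prime ¬prime[1]
prime-cases {2} _ = inj₁ refl
prime-cases {3} _ = inj₂ (inj₁ refl)
prime-cases {4} ℓ-prime = contradiction composite[4] (prime⇒¬composite ℓ-prime)
prime-cases {suc (suc (suc (suc (suc _))))} _ = inj₂ (inj₂ (s≤s (s≤s (s≤s (s≤s (s≤s z≤n))))))

-- Successive differences of the values divide out the factors s - r, u - r, u - s.
quadratic-roots-mod-prime : ∀ {ℓ f₀ f₁ f₂} r s u → Prime ℓ →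
  let f = f₀ ∷ f₁ ∷ f₂ ∷ [] in
  + ℓ ∣ eval f r → + ℓ ∣ eval f s → + ℓ ∣ eval f u →
  ¬ + ℓ ∣ s - r → ¬ + ℓ ∣ u - r → ¬ + ℓ ∣ u - s →
  + ℓ ∣ f₀ × + ℓ ∣ f₁ × + ℓ ∣ f₂
quadratic-roots-mod-prime {ℓ} {f₀} {f₁} {f₂} r s u ℓ-prime ℓ∣fr ℓ∣fs ℓ∣fu ℓ∤s-r ℓ∤u-r ℓ∤u-s =
  ℓ∣f₀ , ℓ∣f₁ , ℓ∣f₂
  where
  f : Poly
  f = f₀ ∷ f₁ ∷ f₂ ∷ []
  cancel : ∀ {x y} → ¬ + ℓ ∣ x → + ℓ ∣ x * y → + ℓ ∣ y
  cancel {x} {y} ℓ∤x ℓ∣xy =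
    [ (λ ℓ∣x → contradiction ℓ∣x ℓ∤x) , (λ ℓ∣y → ℓ∣y) ]′ (euclid-ℤ x y ℓ-prime ℓ∣xy)
  difference : ∀ a b → eval f b - eval f a ≡ (b - a) * (f₁ + f₂ * (a + b))
  difference a b = begin
    eval f b - eval f a                                     ≡⟨ cong₂ _-_ (eval-quadratic f refl b) (eval-quadratic f refl a) ⟩
    (f₂ * b * b + f₁ * b + f₀) - (f₂ * a * a + f₁ * a + f₀) ≡⟨ solve (f₀ ∷ f₁ ∷ f₂ ∷ a ∷ b ∷ []) ⟩
    (b - a) * (f₁ + f₂ * (a + b))                           ∎
    where open ≡-Reasoning
  ℓ∣slope-rs : + ℓ ∣ f₁ + f₂ * (r + s)
  ℓ∣slope-rs = cancel ℓ∤s-r (subst (+ ℓ ∣_) (difference r s) (∣m∣n⇒∣m-n ℓ∣fs ℓ∣fr))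
  ℓ∣slope-ru : + ℓ ∣ f₁ + f₂ * (r + u)
  ℓ∣slope-ru = cancel ℓ∤u-r (subst (+ ℓ ∣_) (difference r u) (∣m∣n⇒∣m-n ℓ∣fu ℓ∣fr))
  ℓ∣f₂ : + ℓ ∣ f₂
  ℓ∣f₂ = cancel ℓ∤u-s (subst (+ ℓ ∣_) slope-difference (∣m∣n⇒∣m-n ℓ∣slope-ru ℓ∣slope-rs))
    where
    slope-difference : (f₁ + f₂ * (r + u)) - (f₁ + f₂ * (r + s)) ≡ (u - s) * f₂
    slope-difference = solve (f₁ ∷ f₂ ∷ r ∷ s ∷ u ∷ [])
  ℓ∣f₁ : + ℓ ∣ f₁
  ℓ∣f₁ = subst (+ ℓ ∣_) linear-term (∣m∣n⇒∣m-n ℓ∣slope-rs (∣n⇒∣m*n (r + s) ℓ∣f₂))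
    where
    linear-term : (f₁ + f₂ * (r + s)) - (r + s) * f₂ ≡ f₁
    linear-term = solve (f₁ ∷ f₂ ∷ r ∷ s ∷ [])
  ℓ∣f₀ : + ℓ ∣ f₀
  ℓ∣f₀ = subst (+ ℓ ∣_) constant-term
    (∣m∣n⇒∣m-n ℓ∣fr (∣n⇒∣m*n r (∣m∣n⇒∣m+n ℓ∣f₁ (∣n⇒∣m*n r ℓ∣f₂))))
    where
    constant-term : eval f r - r * (f₁ + r * f₂) ≡ f₀
    constant-term = trans (cong (_- r * (f₁ + r * f₂)) (eval-quadratic f refl r)) (solve (f₀ ∷ f₁ ∷ f₂ ∷ r ∷ []))

record Triple (P : ℕ → Set) : Set where
  constructor triple
  field
    {i₁ i₂ i₃} : ℕ
    1≤i₁       : 1 ℕ.≤ i₁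
    i₁<i₂      : i₁ ℕ.< i₂
    i₂<i₃      : i₂ ℕ.< i₃
    i₃≤5       : i₃ ℕ.≤ 5
    at-i₁      : P i₁
    at-i₂      : P i₂
    at-i₃      : P i₃

triple-of : ∀ {P : ℕ → Set} {i₁ i₂ i₃} → P i₁ → P i₂ → P i₃ →
  {_ : True (1 ℕ.≤? i₁)} {_ : True (i₁ ℕ.<? i₂)} {_ : True (i₂ ℕ.<? i₃)} {_ : True (i₃ ℕ.≤? 5)} → Triple P
triple-of p₁ p₂ p₃ {1≤i₁} {i₁<i₂} {i₂<i₃} {i₃≤5} =
  triple (toWitness 1≤i₁) (toWitness i₁<i₂) (toWitness i₂<i₃) (toWitness i₃≤5) p₁ p₂ p₃

private
  triple-if-first : ∀ {X Y : ℕ → Set} →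
    X 1 → X 2 ⊎ Y 2 → X 3 ⊎ Y 3 → X 4 ⊎ Y 4 → X 5 ⊎ Y 5 → Triple X ⊎ Triple Y
  triple-if-first x₁ (inj₁ x₂) (inj₁ x₃) _         _         = inj₁ (triple-of x₁ x₂ x₃)
  triple-if-first x₁ (inj₁ x₂) (inj₂ _)  (inj₁ x₄) _         = inj₁ (triple-of x₁ x₂ x₄)
  triple-if-first x₁ (inj₁ x₂) (inj₂ _)  (inj₂ _)  (inj₁ x₅) = inj₁ (triple-of x₁ x₂ x₅)
  triple-if-first _  (inj₁ _)  (inj₂ point₃) (inj₂ y₄) (inj₂ y₅) = inj₂ (triple-of point₃ y₄ y₅)
  triple-if-first x₁ (inj₂ _)  (inj₁ x₃) (inj₁ x₄) _         = inj₁ (triple-of x₁ x₃ x₄)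
  triple-if-first x₁ (inj₂ _)  (inj₁ x₃) (inj₂ _)  (inj₁ x₅) = inj₁ (triple-of x₁ x₃ x₅)
  triple-if-first _  (inj₂ y₂) (inj₁ _)  (inj₂ y₄) (inj₂ y₅) = inj₂ (triple-of y₂ y₄ y₅)
  triple-if-first _  (inj₂ y₂) (inj₂ point₃) (inj₂ y₄) _         = inj₂ (triple-of y₂ point₃ y₄)
  triple-if-first _  (inj₂ y₂) (inj₂ point₃) (inj₁ _)  (inj₂ y₅) = inj₂ (triple-of y₂ point₃ y₅)
  triple-if-first x₁ (inj₂ _)  (inj₂ _)  (inj₁ x₄) (inj₁ x₅) = inj₁ (triple-of x₁ x₄ x₅)

monochromatic-triple : ∀ {X Y : ℕ → Set} →
  X 1 ⊎ Y 1 → X 2 ⊎ Y 2 → X 3 ⊎ Y 3 → X 4 ⊎ Y 4 → X 5 ⊎ Y 5 → Triple X ⊎ Triple Y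
monochromatic-triple (inj₁ x₁) c₂ c₃ c₄ c₅ = triple-if-first x₁ c₂ c₃ c₄ c₅
monochromatic-triple (inj₂ y₁) c₂ c₃ c₄ c₅ =
  Sum.swap (triple-if-first y₁ (Sum.swap c₂) (Sum.swap c₃) (Sum.swap c₄) (Sum.swap c₅))

∤-small-difference : ∀ {ℓ i j} → 5 ℕ.≤ ℓ → 1 ℕ.≤ i → i ℕ.< j → j ℕ.≤ 5 → ¬ + ℓ ∣ + j - + i
∤-small-difference {ℓ} {i} {j} 5≤ℓ 1≤i i<j j≤5 ℓ∣j-i = ℕP.<-irrefl refl (begin-strict
  ℓ       ≤⟨ ℕ∣.∣⇒≤ {{ℕ.>-nonZero (ℕP.m<n⇒0<n∸m i<j)}} (subst (ℓ ℕ∣.∣_) ∣j-i∣≡j∸i (∣⇒∣ᵤ ℓ∣j-i)) ⟩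
  j ℕ.∸ i ≤⟨ ℕP.∸-mono j≤5 1≤i ⟩
  4       <⟨ 5≤ℓ ⟩
  ℓ       ∎)
  where
  open ℕP.≤-Reasoning
  ∣j-i∣≡j∸i : ℤ.∣ + j - + i ∣ ≡ j ℕ.∸ i
  ∣j-i∣≡j∸i =
    trans (cong ℤ.∣_∣ (ℤP.m-n≡m⊖n j i)) (trans (ℤP.∣m⊖n∣≡∣n⊖m∣ j i) (ℤP.∣⊖∣-≤ (ℕP.<⇒≤ i<j)))

triple-of-roots-not-primitive : ∀ {ℓ f₀ f₁ f₂} → Prime ℓ → 5 ℕ.≤ ℓ → Primitive (f₀ ∷ f₁ ∷ f₂ ∷ []) →
  ¬ Triple (λ n → + ℓ ∣ eval (f₀ ∷ f₁ ∷ f₂ ∷ []) (+ n))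
triple-of-roots-not-primitive {ℓ} {f₀} {f₁} {f₂} ℓ-prime 5≤ℓ f-primitive
  (triple {i₁} {i₂} {i₃} 1≤i₁ i₁<i₂ i₂<i₃ i₃≤5 root₁ root₂ root₃) =
  nonTrivial⇒≢1 {{prime⇒nonTrivial ℓ-prime}} (f-primitive ℓ∣coeff)
  where
  ℓ∣coefficients : + ℓ ∣ f₀ × + ℓ ∣ f₁ × + ℓ ∣ f₂
  ℓ∣coefficients = quadratic-roots-mod-prime {ℓ} {f₀} {f₁} {f₂} (+ i₁) (+ i₂) (+ i₃) ℓ-prime root₁ root₂ root₃
    (∤-small-difference 5≤ℓ 1≤i₁ i₁<i₂ (ℕP.<⇒≤ (ℕP.<-≤-trans i₂<i₃ i₃≤5)))
    (∤-small-difference 5≤ℓ 1≤i₁ (ℕP.<-trans i₁<i₂ i₂<i₃) i₃≤5)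
    (∤-small-difference 5≤ℓ (ℕP.≤-trans 1≤i₁ (ℕP.<⇒≤ i₁<i₂)) i₂<i₃ i₃≤5)
  ℓ∣coeff : ∀ i → + ℓ ∣ coeff (f₀ ∷ f₁ ∷ f₂ ∷ []) i
  ℓ∣coeff 0                   = proj₁ ℓ∣coefficients
  ℓ∣coeff 1                   = proj₁ (proj₂ ℓ∣coefficients)
  ℓ∣coeff 2                   = proj₂ (proj₂ ℓ∣coefficients)
  ℓ∣coeff (suc (suc (suc _))) = divides (+ 0) refl

-- Among 1, …, 5 the prime ℓ divides f or g at three points, which are distinct modulo ℓ ≥ 5.
no-fixed-prime-divisor-≥5 : ∀ {ℓ f₀ f₁ f₂ g₀ g₁ g₂} → Prime ℓ → 5 ℕ.≤ ℓ →
  Primitive (f₀ ∷ f₁ ∷ f₂ ∷ []) → Primitive (g₀ ∷ g₁ ∷ g₂ ∷ []) →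
  ¬ (∀ n → 1 ℕ.≤ n → + ℓ ∣ eval (f₀ ∷ f₁ ∷ f₂ ∷ []) (+ n) * eval (g₀ ∷ g₁ ∷ g₂ ∷ []) (+ n))
no-fixed-prime-divisor-≥5 {ℓ} {f₀} {f₁} {f₂} {g₀} {g₁} {g₂} ℓ-prime 5≤ℓ f-primitive g-primitive ℓ∣fg =
  [ triple-of-roots-not-primitive ℓ-prime 5≤ℓ f-primitive , triple-of-roots-not-primitive ℓ-prime 5≤ℓ g-primitive ]′
  (monochromatic-triple (root 0) (root 1) (root 2) (root 3) (root 4))
  where
  f g : Poly
  f = f₀ ∷ f₁ ∷ f₂ ∷ []
  g = g₀ ∷ g₁ ∷ g₂ ∷ []
  root : ∀ n → + ℓ ∣ eval f (+ suc n) ⊎ + ℓ ∣ eval g (+ suc n)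
  root n = euclid-ℤ (eval f (+ suc n)) (eval g (+ suc n)) ℓ-prime (ℓ∣fg (suc n) (s≤s z≤n))

Eventually : (ℕ → Set) → Set
Eventually P = ∃[ N ] (∀ n → N ℕ.≤ n → P n)

eventually-× : ∀ {P Q : ℕ → Set} → Eventually P → Eventually Q → Eventually (λ n → P n × Q n)
eventually-× (M , P≥M) (N , Q≥N) = M ℕ.⊔ N , λ n M⊔N≤n →
  P≥M n (ℕP.≤-trans (ℕP.m≤m⊔n M N) M⊔N≤n) , Q≥N n (ℕP.≤-trans (ℕP.m≤n⊔m M N) M⊔N≤n)

eventually-map : ∀ {P Q : ℕ → Set} → (∀ n → P n → Q n) → Eventually P → Eventually Q
eventually-map P⇒Q (N , P≥N) = N , λ n N≤n → P⇒Q n (P≥N n N≤n)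

0<-⇒< : ∀ {i j} → + 0 < j - i → i < j
0<-⇒< {i} {j} 0<j-i = subst₂ _<_ (ℤP.+-identityʳ i) (i+[j-i]≡j i j) (ℤP.+-monoʳ-< i 0<j-i)
  where
  i+[j-i]≡j : ∀ i j → i + (j - i) ≡ j
  i+[j-i]≡j = solve-∀

<⇒0<- : ∀ {i j} → i < j → + 0 < j - i
<⇒0<- {i} {j} i<j = subst (_< j - i) (ℤP.+-inverseʳ i) (ℤP.+-monoˡ-< (- i) i<j)

*-positive : ∀ {i j} → + 0 < i → + 0 < j → + 0 < i * j
*-positive {+[1+ m ]} {+[1+ n ]} _        _        = +<+ (s≤s z≤n)
*-positive {+ zero}   {_}        (+<+ ()) _
*-positive {+[1+ m ]} {+ zero}   _        (+<+ ())

-∣i∣≤i : ∀ i → - (+ ℤ.∣ i ∣) ≤ i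
-∣i∣≤i (+ n)    = ℤP.neg-≤-pos
-∣i∣≤i -[1+ n ] = ℤP.≤-refl

linear<square : ∀ b g n → suc (b ℕ.+ g) ℕ.≤ n → b ℕ.* n ℕ.+ g ℕ.< n ℕ.* n
linear<square b g n@(suc _) b+g<n = begin-strict
  b ℕ.* n ℕ.+ g           <⟨ ℕP.+-monoʳ-< (b ℕ.* n) (ℕP.n<1+n g) ⟩
  b ℕ.* n ℕ.+ suc g       ≤⟨ ℕP.+-monoʳ-≤ (b ℕ.* n) (ℕP.m≤m*n (suc g) n) ⟩
  b ℕ.* n ℕ.+ suc g ℕ.* n ≡⟨ ℕP.*-distribʳ-+ n b (suc g) ⟨
  (b ℕ.+ suc g) ℕ.* n     ≡⟨ cong (ℕ._* n) (ℕP.+-suc b g) ⟩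
  suc (b ℕ.+ g) ℕ.* n     ≤⟨ ℕP.*-monoˡ-≤ n b+g<n ⟩
  n ℕ.* n                 ∎
  where open ℕP.≤-Reasoning

-- For n > |β| + |γ| the leading term n² already outweighs |β| n + |γ|.
quadratic-eventually-positive : ∀ {α} β γ → + 0 < α → Eventually (λ n → + 0 < α * + n * + n + β * + n + γ)
quadratic-eventually-positive {α} β γ 0<α = suc (b ℕ.+ g) , λ n b+g<n → begin-strict
  + 0                                   <⟨ <⇒0<- (+<+ (linear<square b g n b+g<n)) ⟩
  + (n ℕ.* n) - + (b ℕ.* n ℕ.+ g)
    ≡⟨ cong₂ _-_ (ℤP.pos-* n n) (trans (ℤP.pos-+ (b ℕ.* n) g) (cong (_+ + g) (ℤP.pos-* b n))) ⟩
  + n * + n - (+ b * + n + + g)         ≡⟨ rearrange (+ n) (+ b) (+ g) ⟩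
  + 1 * + n * + n + - + b * + n + - + g ≤⟨ ℤP.+-mono-≤ (ℤP.+-mono-≤ (square-term n) (linear-term n)) (-∣i∣≤i γ) ⟩
  α * + n * + n + β * + n + γ           ∎
  where
  open ℤP.≤-Reasoning
  rearrange : ∀ Y B G → Y * Y - (B * Y + G) ≡ + 1 * Y * Y + - B * Y + - G
  rearrange = solve-∀
  b g : ℕ
  b = ℤ.∣ β ∣
  g = ℤ.∣ γ ∣
  square-term : ∀ n → + 1 * + n * + n ≤ α * + n * + n
  square-term n = ℤP.*-monoʳ-≤-nonNeg (+ n) (ℤP.*-monoʳ-≤-nonNeg (+ n) (ℤP.i<j⇒suc[i]≤j 0<α))
  linear-term : ∀ n → - + b * + n ≤ β * + n
  linear-term n = ℤP.*-monoʳ-≤-nonNeg (+ n) (-∣i∣≤i β)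

eventually-<-quadratic : ∀ f g {f₀ f₁ f₂ g₀ g₁ g₂} → f ≡ f₀ ∷ f₁ ∷ f₂ ∷ [] → g ≡ g₀ ∷ g₁ ∷ g₂ ∷ [] →
                         f₂ < g₂ → Eventually (λ n → eval f (+ n) < eval g (+ n))
eventually-<-quadratic f g {f₀} {f₁} {f₂} {g₀} {g₁} {g₂} refl refl f₂<g₂ =
  eventually-map (λ n 0<g-f → 0<-⇒< (subst (+ 0 <_) (difference (+ n)) 0<g-f))
                 (quadratic-eventually-positive (g₁ - f₁) (g₀ - f₀) (<⇒0<- f₂<g₂))
  where
  difference : ∀ N → (g₂ - f₂) * N * N + (g₁ - f₁) * N + (g₀ - f₀) ≡ eval g N - eval f N
  difference N = begin
    (g₂ - f₂) * N * N + (g₁ - f₁) * N + (g₀ - f₀)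
      ≡⟨ solve (f₀ ∷ f₁ ∷ f₂ ∷ g₀ ∷ g₁ ∷ g₂ ∷ N ∷ []) ⟩
    (g₂ * N * N + g₁ * N + g₀) - (f₂ * N * N + f₁ * N + f₀)
      ≡⟨ cong₂ _-_ (eval-quadratic g refl N) (eval-quadratic f refl N) ⟨
    eval g N - eval f N                                     ∎
    where open ≡-Reasoning

-- Cross-multiplication lemmas: `a * d ≡ n * b` says a/b = n/d.
cross-trans : ∀ {a b a′ b′ n d} .{{_ : ℤ.NonZero b′}} → a * b′ ≡ a′ * b → a′ * d ≡ n * b′ → a * d ≡ n * b
cross-trans {a} {b} {a′} {b′} {n} {d} ab′≡a′b a′d≡nb′ = ℤP.*-cancelʳ-≡ (a * d) (n * b) b′ (begin
  a * d * b′  ≡⟨ solve (a ∷ d ∷ b′ ∷ []) ⟩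
  a * b′ * d  ≡⟨ cong (_* d) ab′≡a′b ⟩
  a′ * b * d  ≡⟨ solve (a′ ∷ b ∷ d ∷ []) ⟩
  a′ * d * b  ≡⟨ cong (_* b) a′d≡nb′ ⟩
  n * b′ * b  ≡⟨ solve (n ∷ b′ ∷ b ∷ []) ⟩
  n * b * b′  ∎)
  where open ≡-Reasoning

cross-+ : ∀ {a b a′ b′ n d m e} → a * d ≡ n * b → a′ * e ≡ m * b′ →
          (a * b′ + a′ * b) * (d * e) ≡ (n * e + m * d) * (b * b′)
cross-+ {a} {b} {a′} {b′} {n} {d} {m} {e} ad≡nb a′e≡mb′ = begin
  (a * b′ + a′ * b) * (d * e)             ≡⟨ solve (a ∷ b ∷ a′ ∷ b′ ∷ d ∷ e ∷ []) ⟩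
  (a * d) * (b′ * e) + (a′ * e) * (b * d) ≡⟨ cong₂ (λ u v → u * (b′ * e) + v * (b * d)) ad≡nb a′e≡mb′ ⟩
  (n * b) * (b′ * e) + (m * b′) * (b * d) ≡⟨ solve (n ∷ b ∷ b′ ∷ e ∷ m ∷ d ∷ []) ⟩
  (n * e + m * d) * (b * b′)              ∎
  where open ≡-Reasoning

cross-* : ∀ {a b a′ b′ n d m e} → a * d ≡ n * b → a′ * e ≡ m * b′ →
          (a * a′) * (d * e) ≡ (n * m) * (b * b′)
cross-* {a} {b} {a′} {b′} {n} {d} {m} {e} ad≡nb a′e≡mb′ = begin
  (a * a′) * (d * e)   ≡⟨ solve (a ∷ a′ ∷ d ∷ e ∷ []) ⟩
  (a * d) * (a′ * e)   ≡⟨ cong₂ _*_ ad≡nb a′e≡mb′ ⟩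
  (n * b) * (m * b′)   ≡⟨ solve (n ∷ b ∷ m ∷ b′ ∷ []) ⟩
  (n * m) * (b * b′)   ∎
  where open ≡-Reasoning

cross-< : ∀ {a b a′ b′ n d m e} → + 0 < b → + 0 < b′ → + 0 < d → + 0 < e →
          a * d ≡ n * b → a′ * e ≡ m * b′ → n * e < m * d → a * b′ < a′ * b
cross-< {a} {b} {a′} {b′} {n} {d} {m} {e} 0<b 0<b′ 0<d 0<e ad≡nb a′e≡mb′ ne<md =
  ℤP.*-cancelʳ-<-nonNeg (d * e) {{ℤ.nonNegative (ℤP.<⇒≤ (*-positive 0<d 0<e))}} (begin-strict
  a * b′ * (d * e)   ≡⟨ solve (a ∷ b′ ∷ d ∷ e ∷ []) ⟩
  (a * d) * (b′ * e) ≡⟨ cong (_* (b′ * e)) ad≡nb ⟩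
  (n * b) * (b′ * e) ≡⟨ solve (n ∷ b ∷ b′ ∷ e ∷ []) ⟩
  (n * e) * (b * b′) <⟨ ℤP.*-monoʳ-<-pos (b * b′) {{ℤ.positive (*-positive 0<b 0<b′)}} ne<md ⟩
  (m * d) * (b * b′) ≡⟨ solve (m ∷ d ∷ b ∷ b′ ∷ []) ⟩
  (m * b′) * (b * d) ≡⟨ cong (_* (b * d)) a′e≡mb′ ⟨
  (a′ * e) * (b * d) ≡⟨ solve (a′ ∷ e ∷ b ∷ d ∷ []) ⟩
  a′ * b * (d * e)   ∎)
  where open ℤP.≤-Reasoning

-- u = n / d by cross-multiplication; d may be any integer.
infix 4 _≈ᵘ_/_ _≈_/_

record _≈ᵘ_/_ (u : ℚᵘ) (n d : ℤ) : Set where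
  constructor cross
  field cross-eq : ℚᵘ.↥ u * d ≡ n * ℚᵘ.↧ u

_≈_/_ : ℚ → ℤ → ℤ → Set
x ≈ n / d = toℚᵘ x ≈ᵘ n / d

≈ᵘ-resp-≃ : ∀ {u v n d} → u ℚᵘ.≃ v → v ≈ᵘ n / d → u ≈ᵘ n / d
≈ᵘ-resp-≃ {mkℚᵘ a b} {mkℚᵘ a′ b′} {n} {d} (*≡* u≃v) (cross v≈n/d) =
  cross (cross-trans {a} {+ suc b} {a′} {+ suc b′} {n} {d} u≃v v≈n/d)

≈ᵘ-+ : ∀ {u v n d m e} → u ≈ᵘ n / d → v ≈ᵘ m / e → u ℚᵘ.+ v ≈ᵘ n * e + m * d / d * e
≈ᵘ-+ {mkℚᵘ a b} {mkℚᵘ a′ b′} {n} {d} {m} {e} (cross u≈n/d) (cross v≈m/e) = cross (trans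
  (cross-+ {a} {+ suc b} {a′} {+ suc b′} {n} {d} {m} {e} u≈n/d v≈m/e)
  (cong ((n * e + m * d) *_) (sym (ℤP.pos-* (suc b) (suc b′)))))

≈ᵘ-* : ∀ {u v n d m e} → u ≈ᵘ n / d → v ≈ᵘ m / e → u ℚᵘ.* v ≈ᵘ n * m / d * e
≈ᵘ-* {mkℚᵘ a b} {mkℚᵘ a′ b′} {n} {d} {m} {e} (cross u≈n/d) (cross v≈m/e) = cross (trans
  (cross-* {a} {+ suc b} {a′} {+ suc b′} {n} {d} {m} {e} u≈n/d v≈m/e)
  (cong ((n * m) *_) (sym (ℤP.pos-* (suc b) (suc b′)))))

≈ᵘ-neg : ∀ {u n d} → u ≈ᵘ n / d → ℚᵘ.- u ≈ᵘ - n / d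
≈ᵘ-neg {mkℚᵘ a b} {n} {d} (cross u≈n/d) =
  cross (trans (sym (ℤP.neg-distribˡ-* a d)) (trans (cong -_ u≈n/d) (ℤP.neg-distribˡ-* n (+ suc b))))

≈ᵘ-∣∣ : ∀ {u n d} → + 0 < d → u ≈ᵘ n / d → ℚᵘ.∣ u ∣ ≈ᵘ + ℤ.∣ n ∣ / d
≈ᵘ-∣∣ {mkℚᵘ a b} {n} {+[1+ d ]} _ (cross u≈n/d) = cross (begin
  + ℤ.∣ a ∣ * + suc d      ≡⟨ ℤP.pos-* ℤ.∣ a ∣ (suc d) ⟨
  + (ℤ.∣ a ∣ ℕ.* suc d)    ≡⟨ cong +_ (ℤP.abs-* a (+ suc d)) ⟨
  + ℤ.∣ a * + suc d ∣      ≡⟨ cong (λ k → + ℤ.∣ k ∣) u≈n/d ⟩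
  + ℤ.∣ n * + suc b ∣      ≡⟨ cong +_ (ℤP.abs-* n (+ suc b)) ⟩
  + (ℤ.∣ n ∣ ℕ.* suc b)    ≡⟨ ℤP.pos-* ℤ.∣ n ∣ (suc b) ⟩
  + ℤ.∣ n ∣ * + suc b      ∎)
  where open ≡-Reasoning
≈ᵘ-∣∣ {d = + zero} (+<+ ())

≈-/ : ∀ n m → n ℚ./ suc m ≈ n / + suc m
≈-/ n m = ≈ᵘ-resp-≃ (ℚP.toℚᵘ-fromℚᵘ (mkℚᵘ n m)) (cross refl)

≈-ratio : ∀ n d → + 0 < d → ratio n d ≈ n / d
≈-ratio n (+[1+ m ]) _        = ≈-/ n m
≈-ratio n (+ zero)   (+<+ ())

≈-+ : ∀ {x y n d m e} → x ≈ n / d → y ≈ m / e → x ℚ.+ y ≈ n * e + m * d / d * e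
≈-+ {x} {y} x≈n/d y≈m/e = ≈ᵘ-resp-≃ (ℚP.toℚᵘ-homo-+ x y) (≈ᵘ-+ x≈n/d y≈m/e)

≈-* : ∀ {x y n d m e} → x ≈ n / d → y ≈ m / e → x ℚ.* y ≈ n * m / d * e
≈-* {x} {y} x≈n/d y≈m/e = ≈ᵘ-resp-≃ (ℚP.toℚᵘ-homo-* x y) (≈ᵘ-* x≈n/d y≈m/e)

≈-neg : ∀ {x n d} → x ≈ n / d → ℚ.- x ≈ - n / d
≈-neg {x} x≈n/d = ≈ᵘ-resp-≃ (ℚP.toℚᵘ-homo‿- x) (≈ᵘ-neg x≈n/d)

≈-- : ∀ {x y n d m e} → x ≈ n / d → y ≈ m / e → x ℚ.- y ≈ n * e - m * d / d * e
≈-- {n = n} {d} {m} {e} x≈n/d y≈m/e =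
  subst (λ k → _ ≈ n * e + k / d * e) (sym (ℤP.neg-distribˡ-* m d)) (≈-+ x≈n/d (≈-neg y≈m/e))

≈-∣∣ : ∀ {x n d} → + 0 < d → x ≈ n / d → ℚ.∣ x ∣ ≈ + ℤ.∣ n ∣ / d
≈-∣∣ {x} 0<d x≈n/d = ≈ᵘ-resp-≃ (ℚP.toℚᵘ-homo-∣-∣ x) (≈ᵘ-∣∣ 0<d x≈n/d)

≈-scale : ∀ {x n d} → x ≈ n / d → ∀ k → x ≈ n * k / d * k
≈-scale {x} {n} {d} (cross x≈n/d) k = cross (begin
  ℚᵘ.↥ (toℚᵘ x) * (d * k)   ≡⟨ ℤP.*-assoc (ℚᵘ.↥ (toℚᵘ x)) d k ⟨
  ℚᵘ.↥ (toℚᵘ x) * d * k     ≡⟨ cong (_* k) x≈n/d ⟩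
  n * ℚᵘ.↧ (toℚᵘ x) * k     ≡⟨ ℤP.*-assoc n (ℚᵘ.↧ (toℚᵘ x)) k ⟩
  n * (ℚᵘ.↧ (toℚᵘ x) * k)   ≡⟨ cong (n *_) (ℤP.*-comm (ℚᵘ.↧ (toℚᵘ x)) k) ⟩
  n * (k * ℚᵘ.↧ (toℚᵘ x))   ≡⟨ ℤP.*-assoc n k (ℚᵘ.↧ (toℚᵘ x)) ⟨
  n * k * ℚᵘ.↧ (toℚᵘ x)     ∎)
  where open ≡-Reasoning

≈-cong : ∀ {x n n′ d d′} → x ≈ n / d → n ≡ n′ → d ≡ d′ → x ≈ n′ / d′
≈-cong x≈n/d refl refl = x≈n/d

≈-< : ∀ {x y n d m e} → + 0 < d → + 0 < e → x ≈ n / d → y ≈ m / e → n * e < m * d → x ℚ.< y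
≈-< {mkℚ a b _} {mkℚ a′ b′ _} {n} {d} {m} {e} 0<d 0<e (cross x≈n/d) (cross y≈m/e) ne<md = ℚ.*<*
  (cross-< {a} {+ suc b} {a′} {+ suc b′} {n} {d} {m} {e} (+<+ (s≤s z≤n)) (+<+ (s≤s z≤n)) 0<d 0<e x≈n/d y≈m/e ne<md)

∣i∣<j : ∀ {i j} → - j < i → i < j → + ℤ.∣ i ∣ < j
∣i∣<j {+ _}      _    i<j = i<j
∣i∣<j { -[1+ _ ]} {j} -j<i _ = subst (_ <_) (ℤP.neg-involutive j) (ℤP.neg-mono-< -j<i)

∣∣<-≈ : ∀ {x n d} ε → + 0 < d → x ≈ n / d →
        + 0 < ℚ.↥ ε * d - ℚ.↧ ε * n → + 0 < ℚ.↥ ε * d + ℚ.↧ ε * n → ℚ.∣ x ∣ ℚ.< ε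
∣∣<-≈ {x} {n} {d} ε@(mkℚ εn e _) 0<d x≈n/d below above =
  ≈-< {m = εn} {+ suc e} 0<d (+<+ (s≤s z≤n)) (≈-∣∣ 0<d x≈n/d) (cross refl) (begin-strict
    + ℤ.∣ n ∣ * + suc e ≡⟨ ℤP.*-comm (+ ℤ.∣ n ∣) (+ suc e) ⟩
    + suc e * + ℤ.∣ n ∣ ≡⟨ ℤP.pos-* (suc e) ℤ.∣ n ∣ ⟨
    + (suc e ℕ.* ℤ.∣ n ∣) ≡⟨ cong +_ (ℤP.abs-* (+ suc e) n) ⟨
    + ℤ.∣ + suc e * n ∣
      <⟨ ∣i∣<j (0<-⇒< (subst (+ 0 <_) (sum-as-difference (εn * d) (+ suc e * n)) above)) (0<-⇒< below) ⟩
    εn * d              ∎)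
  where
  open ℤP.≤-Reasoning
  sum-as-difference : ∀ i j → i + j ≡ j - - i
  sum-as-difference = solve-∀

-- The difference u n - L has numerator F g₂ - f₂ G of degree at most 1 over the denominator
-- G g₂ of degree 2, so both ε-bounds become quadratics with positive leading term ε g₂².
tendsto-quadratic-ratio : ∀ {u : ℕ → ℚ} {L} f g {f₀ f₁ f₂ g₀ g₁ g₂} →
  f ≡ f₀ ∷ f₁ ∷ f₂ ∷ [] → g ≡ g₀ ∷ g₁ ∷ g₂ ∷ [] → + 0 < g₂ → L ≈ f₂ / g₂ →
  (∀ n → + 0 < eval g (+ n) → u n ≈ eval f (+ n) / eval g (+ n)) → Tendsto u L
tendsto-quadratic-ratio {u} {L} f g {f₀} {f₁} {f₂} {g₀} {g₁} {g₂} refl refl 0<g₂ L≈f₂/g₂ u≈f/g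
                        ε@(mkℚ εn e _) 0<ε =
  eventually-map close (eventually-× (quadratic-eventually-positive g₁ g₀ 0<g₂)
    (eventually-× (quadratic-eventually-positive β⁻ γ⁻ 0<εg₂²) (quadratic-eventually-positive β⁺ γ⁺ 0<εg₂²)))
  where
  E β⁻ γ⁻ β⁺ γ⁺ : ℤ
  E  = + suc e
  β⁻ = εn * g₁ * g₂ - E * (f₁ * g₂ - f₂ * g₁)
  γ⁻ = εn * g₀ * g₂ - E * (f₀ * g₂ - f₂ * g₀)
  β⁺ = εn * g₁ * g₂ + E * (f₁ * g₂ - f₂ * g₁)
  γ⁺ = εn * g₀ * g₂ + E * (f₀ * g₂ - f₂ * g₀)
  0<εn : + 0 < εn
  0<εn = subst (+ 0 <_) (ℤP.*-identityʳ εn) (ℚP.drop-*<* 0<ε)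
  0<εg₂² : + 0 < εn * g₂ * g₂
  0<εg₂² = *-positive (*-positive 0<εn 0<g₂) 0<g₂
  below≡ : ∀ E N →
      εn * g₂ * g₂ * N * N + (εn * g₁ * g₂ - E * (f₁ * g₂ - f₂ * g₁)) * N
    + (εn * g₀ * g₂ - E * (f₀ * g₂ - f₂ * g₀))
    ≡ εn * ((g₂ * N * N + g₁ * N + g₀) * g₂)
    - E * ((f₂ * N * N + f₁ * N + f₀) * g₂ - f₂ * (g₂ * N * N + g₁ * N + g₀))
  below≡ E N = solve (εn ∷ E ∷ N ∷ f₀ ∷ f₁ ∷ f₂ ∷ g₀ ∷ g₁ ∷ g₂ ∷ [])
  above≡ : ∀ E N →
      εn * g₂ * g₂ * N * N + (εn * g₁ * g₂ + E * (f₁ * g₂ - f₂ * g₁)) * N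
    + (εn * g₀ * g₂ + E * (f₀ * g₂ - f₂ * g₀))
    ≡ εn * ((g₂ * N * N + g₁ * N + g₀) * g₂)
    + E * ((f₂ * N * N + f₁ * N + f₀) * g₂ - f₂ * (g₂ * N * N + g₁ * N + g₀))
  above≡ E N = solve (εn ∷ E ∷ N ∷ f₀ ∷ f₁ ∷ f₂ ∷ g₀ ∷ g₁ ∷ g₂ ∷ [])
  close : ∀ n → + 0 < g₂ * + n * + n + g₁ * + n + g₀ × + 0 < εn * g₂ * g₂ * + n * + n + β⁻ * + n + γ⁻
                    × + 0 < εn * g₂ * g₂ * + n * + n + β⁺ * + n + γ⁺ → ℚ.∣ u n ℚ.- L ∣ ℚ.< ε
  close n (0<G , below , above) = ∣∣<-≈ ε (*-positive 0<G 0<g₂) (≈-- u≈F/G L≈f₂/g₂)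
    (subst (+ 0 <_) (below≡ E (+ n)) below) (subst (+ 0 <_) (above≡ E (+ n)) above)
    where
    f-value : eval f (+ n) ≡ f₂ * + n * + n + f₁ * + n + f₀
    f-value = eval-quadratic f refl (+ n)
    g-value : eval g (+ n) ≡ g₂ * + n * + n + g₁ * + n + g₀
    g-value = eval-quadratic g refl (+ n)
    u≈F/G : u n ≈ f₂ * + n * + n + f₁ * + n + f₀ / g₂ * + n * + n + g₁ * + n + g₀
    u≈F/G = subst₂ (u n ≈_/_) f-value g-value (u≈f/g n (subst (+ 0 <_) (sym g-value) 0<G))

pq-identity : ∀ a c y → p a c y * q a c y ≡ k a c y * k a c y + + 5 * k a c y + c
pq-identity a c y = subst₂ _≡_
  (sym (cong₂ _*_ (eval-quadratic (pPoly a c) refl y) (eval-quadratic (qPoly a c) refl y)))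
  (sym (cong (λ t → t * t + + 5 * t + c) (eval-quadratic (kPoly a c) refl y)))
  (solve (a ∷ c ∷ y ∷ []))

<-by-excess : ∀ {m n k} → m ℕ.+ suc k ≡ n → m ℕ.< n
<-by-excess {m} refl = ℕP.m<m+n m (s≤s z≤n)

p₂<q₂ : ∀ a → let A = + suc a in A * A * (+ 2 * A + + 1) * (+ 2 * A + + 1) < + 16 * A * A * A * A
p₂<q₂ a = +<+ (<-by-excess identity)
  where
  identity : suc a ℕ.* suc a ℕ.* (2 ℕ.* suc a ℕ.+ 1) ℕ.* (2 ℕ.* suc a ℕ.+ 1)
             ℕ.+ suc a ℕ.* suc a ℕ.* (1 ℕ.+ 2 ℕ.* a) ℕ.* (7 ℕ.+ 6 ℕ.* a)
           ≡ 16 ℕ.* suc a ℕ.* suc a ℕ.* suc a ℕ.* suc a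
  identity = ℕ-Solver.solve (a ∷ [])

q₂<4p₂ : ∀ a → let A = + suc a in + 16 * A * A * A * A < + 4 * (A * A * (+ 2 * A + + 1) * (+ 2 * A + + 1))
q₂<4p₂ a = +<+ (<-by-excess identity)
  where
  identity : 16 ℕ.* suc a ℕ.* suc a ℕ.* suc a ℕ.* suc a ℕ.+ 4 ℕ.* suc a ℕ.* suc a ℕ.* (5 ℕ.+ 4 ℕ.* a)
           ≡ 4 ℕ.* (suc a ℕ.* suc a ℕ.* (2 ℕ.* suc a ℕ.+ 1) ℕ.* (2 ℕ.* suc a ℕ.+ 1))
  identity = ℕ-Solver.solve (a ∷ [])

p<q<4p : ∀ a c → let A = + suc a in
         Eventually (λ y → p A c (+ y) < q A c (+ y) × q A c (+ y) < + 4 * p A c (+ y))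
p<q<4p a c = eventually-×
  (eventually-<-quadratic (pPoly A c) (qPoly A c) refl refl (p₂<q₂ a))
  (eventually-map (λ y → subst (q A c (+ y) <_) (eval-scale (+ 4) (pPoly A c) (+ y)))
                  (eventually-<-quadratic (qPoly A c) (scale (+ 4) (pPoly A c)) refl refl (q₂<4p₂ a)))
  where
  A : ℤ
  A = + suc a

two≈2/1 : ℚ.1ℚ ℚ.+ ℚ.1ℚ ≈ + 2 / + 1
two≈2/1 = cross refl

limQP-≈ : ∀ a → limQP a ≈ eval (+ 0 ∷ + 0 ∷ + 16 ∷ []) (+ a) / eval (+ 1 ∷ + 4 ∷ + 4 ∷ []) (+ a)
limQP-≈ a = with-variable (+ a) (cong (_+_ (+ 1)) (ℤP.pos-* 2 a))
  where
  with-variable : ∀ A → + suc (2 ℕ.* a) ≡ + 1 + + 2 * A →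
                  limQP a ≈ eval (+ 0 ∷ + 0 ∷ + 16 ∷ []) A / eval (+ 1 ∷ + 4 ∷ + 4 ∷ []) A
  with-variable A 2a+1≡ = ≈-cong (≈-* X≈ X≈)
    (sym (trans (eval-quadratic (+ 0 ∷ + 0 ∷ + 16 ∷ []) refl A) (solve (A ∷ []))))
    (sym (trans (eval-quadratic (+ 1 ∷ + 4 ∷ + 4 ∷ []) refl A) (solve (A ∷ []))))
    where
    X≈ : ℚ.1ℚ ℚ.+ ℚ.1ℚ ℚ.- (+ 2 ℚ./ suc (2 ℕ.* a)) ≈ + 2 * (+ 1 + + 2 * A) - + 2 * + 1 / + 1 * (+ 1 + + 2 * A)
    X≈ = ≈-- two≈2/1 (subst (+ 2 ℚ./ suc (2 ℕ.* a) ≈ + 2 /_) 2a+1≡ (≈-/ (+ 2) (2 ℕ.* a)))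

four≈16/4 : + 4 ℚ./ 1 ≈ + 16 / + 4
four≈16/4 = cross refl

four≈4/1 : + 4 ℚ./ 1 ≈ + 4 / + 1
four≈4/1 = cross refl

limQP-tendsto : Tendsto limQP (+ 4 ℚ./ 1)
limQP-tendsto = tendsto-quadratic-ratio (+ 0 ∷ + 0 ∷ + 16 ∷ []) (+ 1 ∷ + 4 ∷ + 4 ∷ []) refl refl
                  (+<+ (s≤s z≤n)) four≈16/4 (λ a _ → limQP-≈ a)

limQP<4 : ∀ a → limQP (suc a) ℚ.< + 4 ℚ./ 1
limQP<4 a = ≈-< (subst (+ 0 <_) (sym (eval-quadratic (+ 1 ∷ + 4 ∷ + 4 ∷ []) refl A)) (+<+ (s≤s z≤n))) (+<+ (s≤s z≤n))
              (limQP-≈ (suc a)) four≈4/1 (0<-⇒< (subst (+ 0 <_) (gap A) (+<+ (s≤s z≤n))))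
  where
  A : ℤ
  A = + suc a
  gap : ∀ A → + 16 * A + + 4 ≡ + 4 * eval (+ 1 ∷ + 4 ∷ + 4 ∷ []) A - eval (+ 0 ∷ + 0 ∷ + 16 ∷ []) A * + 1
  gap A = begin
    + 16 * A + + 4                                                       ≡⟨ solve (A ∷ []) ⟩
    + 4 * (+ 4 * A * A + + 4 * A + + 1) - (+ 16 * A * A + + 0 * A + + 0) * + 1
      ≡⟨ cong₂ (λ u v → + 4 * u - v * + 1)
               (eval-quadratic (+ 1 ∷ + 4 ∷ + 4 ∷ []) refl A) (eval-quadratic (+ 0 ∷ + 0 ∷ + 16 ∷ []) refl A) ⟨
    + 4 * eval (+ 1 ∷ + 4 ∷ + 4 ∷ []) A - eval (+ 0 ∷ + 0 ∷ + 16 ∷ []) A * + 1 ∎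
    where open ≡-Reasoning

limQP-≈-leading : ∀ a → limQP a ≈ + 16 * + a * + a * + a * + a / + a * + a * (+ 2 * + a + + 1) * (+ 2 * + a + + 1)
limQP-≈-leading a = ≈-cong (≈-scale (limQP-≈ a) (+ a * + a)) (scaled-numerator (+ a)) (scaled-denominator (+ a))
  where
  scaled-numerator : ∀ A → eval (+ 0 ∷ + 0 ∷ + 16 ∷ []) A * (A * A) ≡ + 16 * A * A * A * A
  scaled-numerator A = trans (cong (_* (A * A)) (eval-quadratic (+ 0 ∷ + 0 ∷ + 16 ∷ []) refl A)) (solve (A ∷ []))
  scaled-denominator : ∀ A → eval (+ 1 ∷ + 4 ∷ + 4 ∷ []) A * (A * A) ≡ A * A * (+ 2 * A + + 1) * (+ 2 * A + + 1)
  scaled-denominator A = trans (cong (_* (A * A)) (eval-quadratic (+ 1 ∷ + 4 ∷ + 4 ∷ []) refl A)) (solve (A ∷ []))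

q/p-tendsto : ∀ a c → Tendsto (λ y → ratio (q (+ suc a) c (+ y)) (p (+ suc a) c (+ y))) (limQP (suc a))
q/p-tendsto a c = tendsto-quadratic-ratio (qPoly A c) (pPoly A c) refl refl (+<+ (s≤s z≤n)) (limQP-≈-leading (suc a))
                    (λ y 0<p → ≈-ratio (q A c (+ y)) (p A c (+ y)) 0<p)
  where
  A : ℤ
  A = + suc a

p-discriminant : ∀ A c →
    (- (A * (+ 2 * A + + 1) * (+ 8 * A + + 5))) * (- (A * (+ 2 * A + + 1) * (+ 8 * A + + 5)))
    - + 4 * ((+ 4 * c - + 9) * A * A + (+ 4 * c - + 5) * A + c) * (A * A * (+ 2 * A + + 1) * (+ 2 * A + + 1))
  ≡ (A * (+ 2 * A + + 1) * (+ 2 * A + + 1)) * (A * (+ 2 * A + + 1) * (+ 2 * A + + 1)) * (+ 25 - + 4 * c)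
p-discriminant = solve-∀

-- p₀ ≡ c modulo a and 4 p₀ ≡ 1 modulo 2a + 1, while p₂ = a² (2a + 1)².
p-primitive : ∀ A c → A ⊥ c → Primitive (pPoly A c)
p-primitive A c A⊥c = primitive-if-coprime (⊥-* (⊥-* (⊥-* p₀⊥A p₀⊥A) p₀⊥B) p₀⊥B)
  where
  p₀⊥A : (+ 4 * c - + 9) * A * A + (+ 4 * c - + 5) * A + c ⊥ A
  p₀⊥A = ⊥-linear {k = + 1} {x = (+ 4 * c - + 9) * A + (+ 4 * c - + 5)} A⊥c (solve (A ∷ c ∷ []))
  p₀⊥B : (+ 4 * c - + 9) * A * A + (+ 4 * c - + 5) * A + c ⊥ + 2 * A + + 1
  p₀⊥B = ⊥-linear {k = + 4} {x = (+ 8 * c - + 18) * A + + 4 * c - + 1} ⊥-1 (solve (A ∷ c ∷ []))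

p-irreducible : ∀ a c {d} → + suc a ⊥ c → + 25 - + 4 * c ≡ + d → ¬ IsSquare d → Irreducible (pPoly (+ suc a) c)
p-irreducible a c A⊥c 25-4c≡d nonsquare = quadratic-irreducible (λ ()) (p-primitive A c A⊥c)
  (square-times-nonsquareℤ S (trans (p-discriminant A c) (cong (S * S *_) 25-4c≡d)) nonsquare (λ ()))
  where
  A S : ℤ
  A = + suc a
  S = A * (+ 2 * A + + 1) * (+ 2 * A + + 1)

q-discriminant : ∀ A c →
    (- (+ 8 * A * A * (+ 8 * A + + 1))) * (- (+ 8 * A * A * (+ 8 * A + + 1)))
    - + 4 * (+ 4 * (+ 4 * c - + 9) * A * A + + 16 * A + + 1) * (+ 16 * A * A * A * A)
  ≡ (+ 16 * A * A * A) * (+ 16 * A * A * A) * (+ 25 - + 4 * c)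
q-discriminant = solve-∀

-- q₀ is odd and ≡ 1 modulo a, while q₂ = 2⁴ a⁴.
q-primitive : ∀ A c → Primitive (qPoly A c)
q-primitive A c = primitive-if-coprime (⊥-* (⊥-* (⊥-* (⊥-* q₀⊥16 q₀⊥A) q₀⊥A) q₀⊥A) q₀⊥A)
  where
  q₀⊥A : + 4 * (+ 4 * c - + 9) * A * A + + 16 * A + + 1 ⊥ A
  q₀⊥A = ⊥-linear {k = + 1} {x = + 4 * (+ 4 * c - + 9) * A + + 16} ⊥-1 (solve (A ∷ c ∷ []))
  q₀⊥2 : + 4 * (+ 4 * c - + 9) * A * A + + 16 * A + + 1 ⊥ + 2
  q₀⊥2 = ⊥-linear {k = + 1} {x = + 2 * (+ 4 * c - + 9) * A * A + + 8 * A} ⊥-1 (solve (A ∷ c ∷ []))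
  q₀⊥16 : + 4 * (+ 4 * c - + 9) * A * A + + 16 * A + + 1 ⊥ + 16
  q₀⊥16 = ⊥-* (⊥-* (⊥-* q₀⊥2 q₀⊥2) q₀⊥2) q₀⊥2

q-irreducible : ∀ a c {d} → + 25 - + 4 * c ≡ + d → ¬ IsSquare d → Irreducible (qPoly (+ suc a) c)
q-irreducible a c 25-4c≡d nonsquare = quadratic-irreducible (λ ()) (q-primitive A c)
  (square-times-nonsquareℤ S (trans (q-discriminant A c) (cong (S * S *_) 25-4c≡d)) nonsquare (λ ()))
  where
  A S : ℤ
  A = + suc a
  S = + 16 * A * A * A

p-≡c-mod-2 : ∀ a c → + 2 ∣ p a c (+ 1) - c
p-≡c-mod-2 a c = divides (+ 2 * a * a * a * a - + 6 * a * a * a + (+ 2 * c - + 13) * a * a + (+ 2 * c - + 5) * a)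
  (trans (cong (_- c) (eval-quadratic (pPoly a c) refl (+ 1))) (solve (a ∷ c ∷ [])))

q-≡1-mod-2 : ∀ a c → + 2 ∣ q a c (+ 1) - + 1
q-≡1-mod-2 a c = divides (+ 8 * a * a * a * a - + 32 * a * a * a + (+ 8 * c - + 22) * a * a + + 8 * a)
  (trans (cong (_- + 1) (eval-quadratic (qPoly a c) refl (+ 1))) (solve (a ∷ c ∷ [])))

-- For a = 3s + 1 the factors 2a + 1 and 8a + 1 are divisible by 3.
p-≡1-mod-3 : ∀ s c y → + 3 ∣ p (+ 1 + + 3 * s) c y - + 1
p-≡1-mod-3 s c y = divides
  (let a = + 1 + + 3 * s in (+ 2 * s + + 1) * a * y * (a * (+ 2 * a + + 1) * y - (+ 8 * a + + 5))
    + (+ 4 * c - + 9) * (+ 3 * s * s + + 2 * s) + (+ 4 * c - + 5) * s + + 3 * c - + 5)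
  (trans (cong (_- + 1) (eval-quadratic (pPoly (+ 1 + + 3 * s) c) refl y)) (solve (s ∷ c ∷ y ∷ [])))

q-≡y²+c+2-mod-3 : ∀ s c y → + 3 ∣ q (+ 1 + + 3 * s) c y - (y * y + c + + 2)
q-≡y²+c+2-mod-3 s c y = divides
  (let a = + 1 + + 3 * s in (+ 2 * s + + 1) * (+ 2 * a - + 1) * (+ 4 * a * a + + 1) * y * y - + 8 * a * a * (+ 8 * s + + 3) * y
    + + 4 * (+ 4 * c - + 9) * (+ 3 * s * s + + 2 * s) + + 16 * s + + 5 * c - + 7)
  (trans (cong (_- (y * y + c + + 2)) (eval-quadratic (qPoly (+ 1 + + 3 * s) c) refl y)) (solve (s ∷ c ∷ y ∷ [])))

record Admissible (c : ℤ) : Set where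
  field
    ∣c∣∈1,3,5     : ℤ.∣ c ∣ ∈ 1 ∷ 3 ∷ 5 ∷ []
    odd           : ¬ + 2 ∣ c
    point₃            : ℕ
    y²+c+2≢0-mod-3     : ¬ + 3 ∣ + suc point₃ * + suc point₃ + c + + 2
    disc          : ℕ
    25-4c≡disc    : + 25 - + 4 * c ≡ + disc
    disc-nonsquare : ¬ IsSquare disc

admissible : ∀ {c} → c ∈ + 1 ∷ - + 1 ∷ + 3 ∷ - + 3 ∷ + 5 ∷ - + 5 ∷ [] → Admissible c
admissible (here refl) = record
  { ∣c∣∈1,3,5 = here refl ; odd = from-no (+ 2 ∣? + 1) ; point₃ = 0 ; y²+c+2≢0-mod-3 = from-no (+ 3 ∣? + 4)
  ; disc = 21 ; 25-4c≡disc = refl ; disc-nonsquare = from-no (square? 21) }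
admissible (there (here refl)) = record
  { ∣c∣∈1,3,5 = here refl ; odd = from-no (+ 2 ∣? - + 1) ; point₃ = 0 ; y²+c+2≢0-mod-3 = from-no (+ 3 ∣? + 2)
  ; disc = 29 ; 25-4c≡disc = refl ; disc-nonsquare = from-no (square? 29) }
admissible (there (there (here refl))) = record
  { ∣c∣∈1,3,5 = there (here refl) ; odd = from-no (+ 2 ∣? + 3) ; point₃ = 2 ; y²+c+2≢0-mod-3 = from-no (+ 3 ∣? + 14)
  ; disc = 13 ; 25-4c≡disc = refl ; disc-nonsquare = from-no (square? 13) }
admissible (there (there (there (here refl)))) = record
  { ∣c∣∈1,3,5 = there (here refl) ; odd = from-no (+ 2 ∣? - + 3) ; point₃ = 2 ; y²+c+2≢0-mod-3 = from-no (+ 3 ∣? + 8)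
  ; disc = 37 ; 25-4c≡disc = refl ; disc-nonsquare = from-no (square? 37) }
admissible (there (there (there (there (here refl))))) = record
  { ∣c∣∈1,3,5 = there (there (here refl)) ; odd = from-no (+ 2 ∣? + 5) ; point₃ = 0 ; y²+c+2≢0-mod-3 = from-no (+ 3 ∣? + 8)
  ; disc = 5 ; 25-4c≡disc = refl ; disc-nonsquare = from-no (square? 5) }
admissible (there (there (there (there (there (here refl)))))) = record
  { ∣c∣∈1,3,5 = there (there (here refl)) ; odd = from-no (+ 2 ∣? - + 5) ; point₃ = 0 ; y²+c+2≢0-mod-3 = from-no (+ 3 ∣? - + 2)
  ; disc = 45 ; 25-4c≡disc = refl ; disc-nonsquare = from-no (square? 45) }

residues-mod-15 : ∀ a → a % 15 ∈ 1 ∷ 4 ∷ 7 ∷ 13 ∷ [] → a % 3 ≡ 1 × ¬ 3 ℕ∣.∣ a × ¬ 5 ℕ∣.∣ a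
residues-mod-15 a a%15∈ = a%3≡1 , (λ 3∣a → 1≢0 (trans (sym a%3≡1) (ℕ∣.n∣m⇒m%n≡0 a 3 3∣a))) , 5∤a
  where
  residue : ∀ {r} → r ∈ 1 ∷ 4 ∷ 7 ∷ 13 ∷ [] → r % 3 ≡ 1 × ¬ r % 5 ≡ 0
  residue (here refl)                         = refl , λ ()
  residue (there (here refl))                 = refl , λ ()
  residue (there (there (here refl)))         = refl , λ ()
  residue (there (there (there (here refl)))) = refl , λ ()
  a%3≡1 : a % 3 ≡ 1
  a%3≡1 = trans (sym (m∣n⇒o%n%m≡o%m 3 15 a (ℕ∣.divides 5 refl))) (proj₁ (residue a%15∈))
  1≢0 : ¬ 1 ≡ 0
  1≢0 ()
  5∤a : ¬ 5 ℕ∣.∣ a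
  5∤a 5∣a =
    proj₂ (residue a%15∈) (trans (m∣n⇒o%n%m≡o%m 5 15 a (ℕ∣.divides 3 refl)) (ℕ∣.n∣m⇒m%n≡0 a 5 5∣a))

≡1-mod-3 : ∀ a → a % 3 ≡ 1 → + a ≡ + 1 + + 3 * + (a ℕ./ 3)
≡1-mod-3 a a%3≡1 = begin
  + a                          ≡⟨ cong +_ (m≡m%n+[m/n]*n a 3) ⟩
  + (a % 3 ℕ.+ a ℕ./ 3 ℕ.* 3)    ≡⟨ cong (λ r → + (r ℕ.+ a ℕ./ 3 ℕ.* 3)) a%3≡1 ⟩
  + 1 + + (a ℕ./ 3 ℕ.* 3)        ≡⟨ cong (_+_ (+ 1)) (trans (ℤP.pos-* (a ℕ./ 3) 3) (ℤP.*-comm (+ (a ℕ./ 3)) (+ 3))) ⟩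
  + 1 + + 3 * + (a ℕ./ 3)        ∎
  where open ≡-Reasoning

coprime-to-c : ∀ {a c} → Admissible c → ¬ 3 ℕ∣.∣ a → ¬ 5 ℕ∣.∣ a → + a ⊥ c
coprime-to-c {a} {c} c-admissible 3∤a 5∤a = coprime (a⊥ ∣c∣∈)
  where
  open Admissible c-admissible renaming (∣c∣∈1,3,5 to ∣c∣∈)
  a⊥ : ∀ {r} → r ∈ 1 ∷ 3 ∷ 5 ∷ [] → Coprime a r
  a⊥ (here refl)                 = _⊥_.coprime-abs (⊥-1 {+ a})
  a⊥ (there (here refl))         = prime∤⇒coprime (from-yes (prime? 3)) 3∤a
  a⊥ (there (there (here refl))) = prime∤⇒coprime (from-yes (prime? 5)) 5∤a

module _ {a c} (c-admissible : Admissible c) (a%3≡1 : a % 3 ≡ 1) (a⊥c : + a ⊥ c) where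

  open Admissible c-admissible

  no-fixed-prime-divisor :
    ¬ (∃[ ℓ ] (Prime ℓ × (∀ n → 1 ℕ.≤ n → + ℓ Unsigned.∣ p (+ a) c (+ n) * q (+ a) c (+ n))))
  no-fixed-prime-divisor (ℓ , ℓ-prime , ℓ∣pq) with prime-cases ℓ-prime
  ... | inj₁ refl = ∤-* (p (+ a) c (+ 1)) (q (+ a) c (+ 1)) ℓ-prime
    (∤-congruent odd (p-≡c-mod-2 (+ a) c)) (∤-congruent (from-no (+ 2 ∣? + 1)) (q-≡1-mod-2 (+ a) c))
    (∣ᵤ⇒∣ (ℓ∣pq 1 (s≤s z≤n)))
  ... | inj₂ (inj₁ refl) = ∤-* (p (+ a) c y) (q (+ a) c y) ℓ-prime
    (∤-congruent (from-no (+ 3 ∣? + 1))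
      (subst (λ A → + 3 ∣ p A c y - + 1) (sym a≡) (p-≡1-mod-3 (+ (a ℕ./ 3)) c y)))
    (∤-congruent y²+c+2≢0-mod-3
      (subst (λ A → + 3 ∣ q A c y - (y * y + c + + 2)) (sym a≡) (q-≡y²+c+2-mod-3 (+ (a ℕ./ 3)) c y)))
    (∣ᵤ⇒∣ (ℓ∣pq (suc point₃) (s≤s z≤n)))
    where
    y : ℤ
    y = + suc point₃
    a≡ : + a ≡ + 1 + + 3 * + (a ℕ./ 3)
    a≡ = ≡1-mod-3 a a%3≡1
  ... | inj₂ (inj₂ 5≤ℓ) =
    no-fixed-prime-divisor-≥5 ℓ-prime 5≤ℓ (p-primitive (+ a) c a⊥c) (q-primitive (+ a) c)
      (λ n 1≤n → ∣ᵤ⇒∣ (ℓ∣pq n 1≤n))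

conditions : ∀ a c → c ∈ + 1 ∷ - + 1 ∷ + 3 ∷ - + 3 ∷ + 5 ∷ - + 5 ∷ [] → suc a % 15 ∈ 1 ∷ 4 ∷ 7 ∷ 13 ∷ [] →
             Conditions (pPoly (+ suc a) c) (qPoly (+ suc a) c)
conditions a c c∈ a∈ with residues-mod-15 (suc a) a∈
... | a%3≡1 , 3∤a , 5∤a =
    (λ p≈q → ℤP.<⇒≢ (p₂<q₂ a) (p≈q 2))
  , (p-irreducible a c a⊥c 25-4c≡disc disc-nonsquare , q-irreducible a c 25-4c≡disc disc-nonsquare)
  , (+<+ (s≤s z≤n) , +<+ (s≤s z≤n))
  , no-fixed-prime-divisor c-admissible a%3≡1 a⊥c
  where
  c-admissible : Admissible c
  c-admissible = admissible c∈
  open Admissible c-admissible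
  a⊥c : + suc a ⊥ c
  a⊥c = coprime-to-c c-admissible 3∤a 5∤a

lemma5p4 :
  -- (1) the identity  pq = k² + 5k + c
  (∀ (a y : ℕ) (c : ℤ) → 1 ℕ.≤ a → 1 ℕ.≤ y →
     p (+ a) c (+ y) ℤ.* q (+ a) c (+ y)
       ≡ k (+ a) c (+ y) ℤ.* k (+ a) c (+ y) ℤ.+ + 5 ℤ.* k (+ a) c (+ y) ℤ.+ c)
  -- p < q < 4p for all sufficiently large y
  × (∀ (a : ℕ) (c : ℤ) → 1 ℕ.≤ a →
       ∃[ Y ] (∀ (y : ℕ) → Y ℕ.≤ y →
         (p (+ a) c (+ y) ℤ.< q (+ a) c (+ y))
         × (q (+ a) c (+ y) ℤ.< + 4 ℤ.* p (+ a) c (+ y))))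
  -- lim_{y→∞} q/p = (2 − 2/(2a+1))²
  × (∀ (a : ℕ) (c : ℤ) → 1 ℕ.≤ a →
       Tendsto (λ y → ratio (q (+ a) c (+ y)) (p (+ a) c (+ y))) (limQP a))
  -- (2 − 2/(2a+1))² < 4
  × (∀ (a : ℕ) → 1 ℕ.≤ a → limQP a ℚ.< (+ 4 ℚ./ 1))
  -- lim_{a→∞} lim_{y→∞} q/p = 4
  × Tendsto limQP (+ 4 ℚ./ 1)
  -- (2) conditions (i)–(iv) for f₁ = p(y), f₂ = q(y)
  × (∀ (a : ℕ) (c : ℤ) → 1 ℕ.≤ a →
       c ∈ (+ 1 ∷ ℤ.- + 1 ∷ + 3 ∷ ℤ.- + 3 ∷ + 5 ∷ ℤ.- + 5 ∷ []) →
       (a % 15) ∈ (1 ∷ 4 ∷ 7 ∷ 13 ∷ []) →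
       Conditions (pPoly (+ a) c) (qPoly (+ a) c))
lemma5p4 =
    (λ a y c _ _ → pq-identity (+ a) c (+ y))
  , (λ { (suc a) c (s≤s z≤n) → p<q<4p a c })
  , (λ { (suc a) c (s≤s z≤n) → q/p-tendsto a c })
  , (λ { (suc a) (s≤s z≤n) → limQP<4 a })
  , limQP-tendsto
  , (λ { (suc a) c (s≤s z≤n) → conditions a c })
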